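{- Let $n\ge2$ and let $0\le\alpha_1<\dots<\alpha_n$ be integers. If there exists a correct score sequence for $D=\{\alpha_1,\dots,\alpha_n\}$, i.e. positive integers $x_1,\dots,x_n$ such that the non-decreasing sequence consisting of $\alpha_i$ repeated $x_i$ times ($i=1,\dots,n$) is the score sequence of some tournament, then the reconstruction variant of the net-building algorithm (described in the context), run on $D$, finds at least one correct score sequence: some cell of $L_n$ is nonempty, and starting from it and repeatedly following a stored triple $(p',q',x)$ in $L_\ell(p,q)$ to the cell $L_{\ell-1}(p',q')$ while recording $x_\ell=x$, for $\ell=n,n-1,\dots,1$, yields a correct score sequence $(x_1,\dots,x_n)$ for $D$.
   Context: A tournament is an orientation of a complete graph; its score sequence is its sequence of out-degrees. Reconstruction variant of the net-building algorithm: set $\alpha_0=0$. For $k=0,\dots,n$ there is a table $L_k$ with cells indexed by integer pairs $(p,q)$, $0\le p\le 2\alpha_k+1$, $0\le q\le(2\alpha_k+1)\alpha_k$; each cell is a set of triples $(p',q',x)$, initially empty except $L_0(0,0)=\{(0,0,0)\}$. Let $B(p',q',a)=\frac{h+\sqrt{h^2+8(q'-p'(p'-1)/2)}}{2}$ with $h=2(a-p')+1$. First part: for $\ell=1,\dots,n-1$, for each integer $x$ with $1\le x\le 2\alpha_\ell+1$, for each $(p',q')$ with $0\le p'\le 2\alpha_{\ell-1}+1$, $0\le q'\le(2\alpha_{\ell-1}+1)\alpha_{\ell-1}$ and $L_{\ell-1}(p',q')\ne\emptyset$: if $x\le B(p',q',\alpha_\ell)$ and $L_\ell(p'+x,q'+x\alpha_\ell)$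 is currently empty, insert $(p',q',x)$ into it. Second part: for each $(p',q')$ in the index range of $L_{n-1}$ with $L_{n-1}(p',q')\ne\emptyset$, let $t=B(p',q',\alpha_n)$; if $t$ is an integer with $t\ge1$ and $L_n(p'+t,q'+t\alpha_n)$ is currently empty, insert $(p',q',t)$ into it. -}

module Defs where

open import Data.Bool using (Bool; true; false; not; if_then_else_; _∧_)
open import Data.Nat using (ℕ; zero; suc; _+_; _*_; _∸_; _≤_; _<_; _≡ᵇ_; _%_; _/_)
open import Data.Integer as ℤ using (ℤ; +_)
open import Data.Fin using (Fin)
open import Data.Nat.ListAction using (sum)
open import Data.List using (List; []; _∷_; _++_; replicate; map; concatMap; foldl; upTo; allFin; length; lookup)
open import Data.Vec using (Vec; []; _∷_; _∷ʳ_)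
open import Data.Maybe using (Maybe; just; nothing; is-just; is-nothing)
open import Data.Product using (Σ; _×_; _,_)
open import Relation.Binary.PropositionalEquality using (_≡_; _≢_)

record Tournament (m : ℕ) : Set where
  field
    beats  : Fin m → Fin m → Bool
    irrefl : ∀ i → beats i i ≡ false
    orient : ∀ i j → i ≢ j → beats i j ≡ not (beats j i)

open Tournament public

outdeg : ∀ {m} → Tournament m → Fin m → ℕ
outdeg {m} T i = sum (map (λ j → if beats T i j then 1 else 0) (allFin m))

IsScoreSequence : List ℕ → Set
IsScoreSequence s =
  Σ (Tournament (length s)) λ T → ∀ i → outdeg T i ≡ lookup s i

expand : ∀ {k} → (ℕ → ℕ) → ℕ → Vec ℕ k → List ℕ
expand α i []       = []
expand α i (x ∷ xs) = replicate x (α i) ++ expand α (suc i) xs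

data AllPos : ∀ {k} → Vec ℕ k → Set where
  []  : AllPos []
  _∷_ : ∀ {k x} {xs : Vec ℕ k} → 1 ≤ x → AllPos xs → AllPos (x ∷ xs)

CorrectScoreSeq : ∀ {n} → (ℕ → ℕ) → Vec ℕ n → Set
CorrectScoreSeq α xs = AllPos xs × IsScoreSequence (expand α 1 xs)

StrictlyIncreasing : ℕ → (ℕ → ℕ) → Set
StrictlyIncreasing n α = ∀ i → 1 ≤ i → i < n → α i < α (suc i)

A : (ℕ → ℕ) → ℕ → ℕ
A α zero    = 0
A α (suc ℓ) = α (suc ℓ)

Triple : Set
Triple = ℕ × ℕ × ℕ

-- a cell holds at most one triple (insertion only happens into empty cells)
Table : Set
Table = ℕ → ℕ → Maybe Triple

insertIfEmpty : ℕ → ℕ → Triple → Table → Table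
insertIfEmpty p q t L a b =
  if (a ≡ᵇ p) ∧ (b ≡ᵇ q) ∧ is-nothing (L p q) then just t else L a b

InRange : ℕ → ℕ → ℕ → Set
InRange a p q = p ≤ 2 * a + 1 × q ≤ (2 * a + 1) * a

rangeList : ℕ → List (ℕ × ℕ)
rangeList a =
  concatMap (λ p → map (λ q → (p , q)) (upTo (suc ((2 * a + 1) * a))))
            (upTo (suc (2 * a + 1)))

hB : ℕ → ℕ → ℤ
hB p' a = (+ (2 * a + 1)) ℤ.- (+ (2 * p'))

discB : ℕ → ℕ → ℕ → ℤ
discB p' q' a = (hB p' a ℤ.* hB p' a) ℤ.+ (+ (8 * q')) ℤ.- (+ (4 * (p' * (p' ∸ 1))))

-- x ≤ B(p',q',a) = (h + √disc)/2, i.e. 2x - h ≤ √disc  (false if disc < 0)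
leB : ℕ → ℕ → ℕ → ℕ → Bool
leB p' q' a x =
  let d = discB p' q' a
      y = (+ (2 * x)) ℤ.- hB p' a
  in (+ 0 ℤ.≤ᵇ d) ∧ ((y ℤ.≤ᵇ + 0) Data.Bool.∨ ((y ℤ.* y) ℤ.≤ᵇ d))

exactSqrt : ℕ → Maybe ℕ
exactSqrt d = go (upTo (suc d))
  where
  go : List ℕ → Maybe ℕ
  go []       = nothing
  go (s ∷ ss) = if (s * s) ≡ᵇ d then just s else go ss

-- B(p',q',a) if it is an integer t ≥ 1, otherwise nothing
intB : ℕ → ℕ → ℕ → Maybe ℕ
intB p' q' a with + 0 ℤ.≤ᵇ discB p' q' a
... | false = nothing
... | true with exactSqrt ℤ.∣ discB p' q' a ∣
...   | nothing = nothing
...   | just s  =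
  let u = (+ s) ℤ.+ hB p' a in
  if ((+ 2) ℤ.≤ᵇ u) ∧ ((ℤ.∣ u ∣ % 2) ≡ᵇ 0) then just (ℤ.∣ u ∣ / 2) else nothing

L₀ : Table
L₀ a b = if (a ≡ᵇ 0) ∧ (b ≡ᵇ 0) then just (0 , 0 , 0) else nothing

-- An iteration order for the first part: for level ℓ and value x,
-- the order in which the pairs (p',q') of the index range of L_{ℓ-1} are visited.
Order : Set
Order = ℕ → ℕ → List (ℕ × ℕ)

buildLevel : (ℕ → ℕ) → Order → ℕ → Table → Table
buildLevel α ord ℓ Lprev =
  foldl (λ L x → foldl (stepPair x) L (ord ℓ x)) (λ _ _ → nothing)
        (map suc (upTo (2 * A α ℓ + 1)))
  where
  stepPair : ℕ → Table → ℕ × ℕ → Table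
  stepPair x L (p' , q') =
    if is-just (Lprev p' q') ∧ leB p' q' (A α ℓ) x
    then insertIfEmpty (p' + x) (q' + x * A α ℓ) (p' , q' , x) L
    else L

firstPart : (ℕ → ℕ) → Order → ℕ → Table
firstPart α ord zero    = L₀
firstPart α ord (suc ℓ) = buildLevel α ord (suc ℓ) (firstPart α ord ℓ)

secondPart : (ℕ → ℕ) → Order → List (ℕ × ℕ) → ℕ → Table
secondPart α ord ordF n =
  foldl stepPair (λ _ _ → nothing) ordF
  where
  Lprev : Table
  Lprev = firstPart α ord (n ∸ 1)
  stepPair : Table → ℕ × ℕ → Table
  stepPair L (p' , q') with is-just (Lprev p' q') | intB p' q' (α n)
  ... | true | just t = insertIfEmpty (p' + t) (q' + t * α n) (p' , q' , t) L
  ... | _    | _      = L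

netTable : (ℕ → ℕ) → Order → List (ℕ × ℕ) → ℕ → ℕ → Table
netTable α ord ordF n ℓ =
  if ℓ ≡ᵇ n then secondPart α ord ordF n else firstPart α ord ℓ

backtrack : (ℕ → Table) → (ℓ : ℕ) → ℕ → ℕ → Maybe (Vec ℕ ℓ)
backtrack L zero    p q = just []
backtrack L (suc ℓ) p q with L (suc ℓ) p q
... | nothing             = nothing
... | just (p' , q' , x) with backtrack L ℓ p' q'
...   | nothing = nothing
...   | just xs = just (xs ∷ʳ x)

-- By Landau's theorem a non-decreasing sequence s₀ ≤ ⋯ ≤ s_{m-1} is a score sequence iff
-- s₀ + ⋯ + s_{k-1} ≥ C(k,2) for every k ≤ m, with equality for k = m. Necessity is double counting.
-- For sufficiency, as long as some inequality is strict, a unit of score is moved from the start to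
-- the end of a maximal run of strict inequalities; this terminates at (0, 1, …, m-1), which the
-- transitive tournament realises, and each move is undone in a tournament by reversing an arc u → v
-- or a path u → w → v (one of them exists unless v dominates u).
--
-- Completing the square, x ≤ B(p', q', a) says exactly C(p'+x, 2) ≤ q' + x a, and B(p', q', a) = t
-- says C(p'+t, 2) = q' + t a. As C(k,2) is convex, Landau's inequalities inside a block of equal
-- entries follow from those at its two ends. Hence backtracking from any stored cell reconstructs a
-- non-decreasing sequence satisfying Landau's conditions, i.e. a correct score sequence; conversely
-- the prefixes of a given correct score sequence, cut at block boundaries, pass every test, so their
-- cells (length, sum) get filled, in particular one cell of L_n.

module Submission where

open import Defs
open import Data.Nat using (ℕ; _≤_; _<_; _∸_)
open import Data.Vec using (Vec)
open import Data.List using (List)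
open import Data.Maybe using (just)
open import Data.Product using (Σ; _×_; _,_)
open import Data.List.Relation.Binary.Permutation.Propositional using (_↭_)
open import Relation.Binary.PropositionalEquality using (_≡_)

open import Algebra.Bundles using (AbelianGroup)
open import Data.Bool using (Bool; true; false; not; if_then_else_; _∧_; _∨_)
import Data.Bool as Bool
open import Data.Bool.Properties using (∧-comm; ∨-comm; ∧-zeroʳ; ¬-not; T-≡; T-∧; T-∨)
open import Data.Fin as Fin using (Fin; toℕ; fromℕ<)
import Data.Fin.Properties as Fin
open import Data.Integer as ℤ using (ℤ; +≤+)
import Data.Integer.Properties as ℤₚ
import Data.Integer.Tactic.RingSolver as ℤ-Ring
open import Data.List
  using ([]; _∷_; _++_; replicate; map; length; lookup; allFin; tabulate; applyUpTo; foldl; upTo)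
import Data.List.Properties as List
open import Data.List.Membership.Propositional using (_∈_)
import Data.List.Membership.Propositional.Properties as Membership
open import Data.List.Relation.Binary.Permutation.Propositional using (↭-sym)
import Data.List.Relation.Binary.Permutation.Propositional.Properties as Permutation
open import Data.List.Relation.Unary.Any using (here; there)
open import Data.Maybe using (Maybe; nothing; is-just; is-nothing)
open import Data.Maybe.Properties using (just-injective)
open import Data.Nat
  using (zero; suc; _+_; _*_; _%_; _/_; z≤n; s≤s; _≤?_; _<?_; _≟_; _≡ᵇ_; _<ᵇ_; _⊓_; pred; >-nonZero)
open import Data.Nat.DivMod using (m≡m%n+[m/n]*n; m*n%n≡0; m*n/n≡m)
open import Data.Nat.Induction using (<-wellFounded)
open import Data.Nat.ListAction using (sum)
import Data.Nat.ListAction.Properties as ListAction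
open import Data.Nat.Properties
open import Data.Nat.Tactic.RingSolver using (solve-∀)
open import Data.Product using (proj₁; proj₂; ∃; map₁)
open import Data.Sum as Sum using (_⊎_; inj₁; inj₂)
open import Data.Vec using ([]; _∷_; _∷ʳ_; initLast)
open import Function using (_∘_; id; _⇔_; mk⇔; Equivalence)
open import Induction.WellFounded using (Acc; acc)
open import Relation.Binary.Definitions using (tri<; tri≈; tri>)
open import Relation.Binary.PropositionalEquality
  using (refl; sym; trans; cong; cong₂; subst; subst₂; _≢_; ≢-sym; module ≡-Reasoning)
open import Relation.Nullary using (¬_; Dec; yes; no; contradiction)
open import Relation.Nullary.Decidable using (_×-dec_)
open import Relation.Unary using (Decidable)
open import Algebra.Properties.CommutativeSemigroup +-commutativeSemigroup using (interchange; xy∙z≈xz∙y)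
open import Algebra.Properties.Group (AbelianGroup.group ℤₚ.+-0-abelianGroup) using (∙-cancelˡ; ∙-cancelʳ)

-- Finite sums and C(k,2)

sumBelow : ℕ → (ℕ → ℕ) → ℕ
sumBelow zero    f = 0
sumBelow (suc k) f = sumBelow k f + f k

sumBelow-cong : ∀ k {f g} → (∀ i → i < k → f i ≡ g i) → sumBelow k f ≡ sumBelow k g
sumBelow-cong zero    f≡g = refl
sumBelow-cong (suc k) f≡g =
  cong₂ _+_ (sumBelow-cong k (λ i i<k → f≡g i (m<n⇒m<1+n i<k))) (f≡g k ≤-refl)

sumBelow-mono : ∀ k {f g} → (∀ i → i < k → f i ≤ g i) → sumBelow k f ≤ sumBelow k g
sumBelow-mono zero    f≤g = z≤n
sumBelow-mono (suc k) f≤g =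
  +-mono-≤ (sumBelow-mono k (λ i i<k → f≤g i (m<n⇒m<1+n i<k))) (f≤g k ≤-refl)

sumBelow-mono-< : ∀ k {f g} → (∀ i → i < k → f i ≤ g i) →
                  ∀ j → j < k → f j < g j → sumBelow k f < sumBelow k g
sumBelow-mono-< (suc k) f≤g j j<1+k fj<gj with j ≟ k
... | yes refl = +-mono-≤-< (sumBelow-mono k (λ i i<k → f≤g i (m<n⇒m<1+n i<k))) fj<gj
... | no j≢k   = +-mono-<-≤
  (sumBelow-mono-< k (λ i i<k → f≤g i (m<n⇒m<1+n i<k)) j (≤∧≢⇒< (≤-pred j<1+k) j≢k) fj<gj)
  (f≤g k ≤-refl)

sumBelow-+ : ∀ k f g → sumBelow k (λ i → f i + g i) ≡ sumBelow k f + sumBelow k g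
sumBelow-+ zero    f g = refl
sumBelow-+ (suc k) f g = begin
  sumBelow k (λ i → f i + g i) + (f k + g k)      ≡⟨ cong (_+ (f k + g k)) (sumBelow-+ k f g) ⟩
  sumBelow k f + sumBelow k g + (f k + g k)       ≡⟨ interchange (sumBelow k f) (sumBelow k g) (f k) (g k) ⟩
  sumBelow k f + f k + (sumBelow k g + g k)       ∎
  where open ≡-Reasoning

sumBelow-const : ∀ k c → sumBelow k (λ _ → c) ≡ k * c
sumBelow-const zero    c = refl
sumBelow-const (suc k) c = trans (cong (_+ c) (sumBelow-const k c)) (+-comm (k * c) c)

sumBelow-monoˡ : ∀ f {k m} → k ≤ m → sumBelow k f ≤ sumBelow m f
sumBelow-monoˡ f {m = zero}  z≤n = ≤-refl
sumBelow-monoˡ f {k} {suc m} k≤1+m with m≤n⇒m<n∨m≡n k≤1+m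
... | inj₂ refl = ≤-refl
... | inj₁ k<1+m = ≤-trans (sumBelow-monoˡ f (≤-pred k<1+m)) (m≤m+n (sumBelow m f) (f m))

sumBelow-suc : ∀ k f → sumBelow (suc k) f ≡ f 0 + sumBelow k (λ i → f (suc i))
sumBelow-suc zero    f = +-comm 0 (f 0)
sumBelow-suc (suc k) f =
  trans (cong (_+ f (suc k)) (sumBelow-suc k f)) (+-assoc (f 0) _ (f (suc k)))

sumBelow-split : ∀ k l f → sumBelow (k + l) f ≡ sumBelow k f + sumBelow l (λ i → f (k + i))
sumBelow-split k zero    f = trans (cong (λ m → sumBelow m f) (+-identityʳ k)) (sym (+-identityʳ _))
sumBelow-split k (suc l) f = begin
  sumBelow (k + suc l) f                                          ≡⟨ cong (λ m → sumBelow m f) (+-suc k l) ⟩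
  sumBelow (k + l) f + f (k + l)                                  ≡⟨ cong (_+ f (k + l)) (sumBelow-split k l f) ⟩
  sumBelow k f + sumBelow l (λ i → f (k + i)) + f (k + l)         ≡⟨ +-assoc (sumBelow k f) _ _ ⟩
  sumBelow k f + (sumBelow l (λ i → f (k + i)) + f (k + l))       ∎
  where open ≡-Reasoning

C₂ : ℕ → ℕ
C₂ zero    = 0
C₂ (suc k) = C₂ k + k

2*C₂+n≡n*n : ∀ k → 2 * C₂ k + k ≡ k * k
2*C₂+n≡n*n zero    = refl
2*C₂+n≡n*n (suc k) = begin
  2 * (C₂ k + k) + suc k         ≡⟨ regroup (C₂ k) k ⟩
  2 * C₂ k + k + suc (k + k)     ≡⟨ cong (_+ suc (k + k)) (2*C₂+n≡n*n k) ⟩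
  k * k + suc (k + k)            ≡⟨ square k ⟩
  suc k * suc k                  ∎
  where
  open ≡-Reasoning
  regroup : ∀ c k → 2 * (c + k) + suc k ≡ 2 * c + k + suc (k + k)
  regroup = solve-∀
  square : ∀ k → k * k + suc (k + k) ≡ suc k * suc k
  square = solve-∀

C₂-+ : ∀ p x → C₂ (p + x) ≡ C₂ p + p * x + C₂ x
C₂-+ p zero rewrite +-identityʳ p | *-zeroʳ p = sym (trans (+-identityʳ (C₂ p + 0)) (+-identityʳ (C₂ p)))
C₂-+ p (suc x) = begin
  C₂ (p + suc x)                   ≡⟨ cong C₂ (+-suc p x) ⟩
  C₂ (p + x) + (p + x)             ≡⟨ cong (_+ (p + x)) (C₂-+ p x) ⟩
  C₂ p + p * x + C₂ x + (p + x)    ≡⟨ regroup (C₂ p) p x (C₂ x) ⟩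
  C₂ p + p * suc x + (C₂ x + x)    ∎
  where
  open ≡-Reasoning
  regroup : ∀ c p x d → c + p * x + d + (p + x) ≡ c + p * suc x + (d + x)
  regroup = solve-∀

C₂≤⇒square≤ : ∀ k M → C₂ k ≤ M → k * k ≤ 2 * M + k
C₂≤⇒square≤ k M le = subst (_≤ 2 * M + k) (2*C₂+n≡n*n k) (+-monoˡ-≤ k (*-monoʳ-≤ 2 le))

square≤⇒C₂≤ : ∀ k M → k * k ≤ 2 * M + k → C₂ k ≤ M
square≤⇒C₂≤ k M le =
  *-cancelˡ-≤ 2 (+-cancelʳ-≤ k (2 * C₂ k) (2 * M) (subst (_≤ 2 * M + k) (sym (2*C₂+n≡n*n k)) le))

C₂≤square : ∀ x → C₂ x ≤ x * x
C₂≤square x = subst (C₂ x ≤_) (2*C₂+n≡n*n x) (≤-trans (m≤m+n (C₂ x) (1 * C₂ x)) (m≤m+n _ x))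

C₂<square : ∀ {x} → 1 ≤ x → C₂ x < x * x
C₂<square {x} 1≤x = subst (C₂ x <_) (2*C₂+n≡n*n x)
  (<-≤-trans (m<m+n (C₂ x) 1≤x) (+-monoˡ-≤ x (m≤m+n (C₂ x) (1 * C₂ x))))

-- Landau's theorem

-- 0 past the end of the list
at : List ℕ → ℕ → ℕ
at []       _       = 0
at (x ∷ xs) zero    = x
at (x ∷ xs) (suc i) = at xs i

lookup≡at : (xs : List ℕ) (i : Fin (length xs)) → lookup xs i ≡ at xs (toℕ i)
lookup≡at (x ∷ xs) Fin.zero    = refl
lookup≡at (x ∷ xs) (Fin.suc i) = lookup≡at xs i

at-++ˡ : ∀ xs ys i → i < length xs → at (xs ++ ys) i ≡ at xs i
at-++ˡ (x ∷ xs) ys zero    _         = refl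
at-++ˡ (x ∷ xs) ys (suc i) (s≤s i<n) = at-++ˡ xs ys i i<n

at-++ʳ : ∀ xs ys i → at (xs ++ ys) (length xs + i) ≡ at ys i
at-++ʳ []       ys i = refl
at-++ʳ (x ∷ xs) ys i = at-++ʳ xs ys i

at-replicate : ∀ x a i → i < x → at (replicate x a) i ≡ a
at-replicate (suc x) a zero    _         = refl
at-replicate (suc x) a (suc i) (s≤s i<x) = at-replicate x a i i<x

at-++-replicate : ∀ xs x a i → length xs ≤ i → i < length xs + x → at (xs ++ replicate x a) i ≡ a
at-++-replicate []       x a i       _         i<x       = at-replicate x a i i<x
at-++-replicate (_ ∷ xs) x a (suc i) (s≤s n≤i) (s≤s i<x) = at-++-replicate xs x a i n≤i i<x

sumBelow-at : ∀ xs → sumBelow (length xs) (at xs) ≡ sum xs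
sumBelow-at []       = refl
sumBelow-at (x ∷ xs) = trans (sumBelow-suc (length xs) (at (x ∷ xs))) (cong (x +_) (sumBelow-at xs))

sum-replicate : ∀ x a → sum (replicate x a) ≡ x * a
sum-replicate zero    a = refl
sum-replicate (suc x) a = cong (a +_) (sum-replicate x a)

length-++-replicate : ∀ xs x (a : ℕ) → length (xs ++ replicate x a) ≡ length xs + x
length-++-replicate xs x a = trans (List.length-++ xs) (cong (length xs +_) (List.length-replicate x))

sum-++-replicate : ∀ xs x a → sum (xs ++ replicate x a) ≡ sum xs + x * a
sum-++-replicate xs x a = trans (ListAction.sum-++ xs (replicate x a)) (cong (sum xs +_) (sum-replicate x a))

Sorted : ℕ → (ℕ → ℕ) → Set
Sorted m s = ∀ i → suc i < m → s i ≤ s (suc i)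

LandauBounds : ℕ → (ℕ → ℕ) → Set
LandauBounds m s = ∀ k → k ≤ m → C₂ k ≤ sumBelow k s

IsSorted : List ℕ → Set
IsSorted xs = Sorted (length xs) (at xs)

IsLandau : List ℕ → Set
IsLandau xs = LandauBounds (length xs) (at xs)

BoundedBy : ℕ → List ℕ → Set
BoundedBy c xs = ∀ i → i < length xs → at xs i ≤ c

Sorted⇒monotone : ∀ {m s} → Sorted m s → ∀ {i j} → i ≤ j → j < m → s i ≤ s j
Sorted⇒monotone sorted {j = zero}  z≤n   _   = ≤-refl
Sorted⇒monotone sorted {j = suc j} i≤1+j 1+j<m with m≤n⇒m<n∨m≡n i≤1+j
... | inj₂ refl = ≤-refl
... | inj₁ i<1+j = ≤-trans (Sorted⇒monotone sorted (≤-pred i<1+j) (<-trans (n<1+n j) 1+j<m)) (sorted j 1+j<m)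

IsLandau⇒C₂≤sum : ∀ xs → IsLandau xs → C₂ (length xs) ≤ sum xs
IsLandau⇒C₂≤sum xs landau = subst (C₂ (length xs) ≤_) (sumBelow-at xs) (landau (length xs) ≤-refl)

IsLandau-prefix : ∀ xs ys → IsLandau (xs ++ ys) → C₂ (length xs) ≤ sum xs
IsLandau-prefix xs ys landau = subst (C₂ (length xs) ≤_) prefix-sum
  (landau (length xs) (subst (length xs ≤_) (sym (List.length-++ xs)) (m≤m+n (length xs) (length ys))))
  where
  prefix-sum : sumBelow (length xs) (at (xs ++ ys)) ≡ sum xs
  prefix-sum = trans (sumBelow-cong (length xs) (λ i i<n → at-++ˡ xs ys i i<n)) (sumBelow-at xs)

bit : Bool → ℕ
bit b = if b then 1 else 0

bit-not : ∀ c → bit (not c) + bit c ≡ 1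
bit-not true  = refl
bit-not false = refl

IsTournament : ℕ → (ℕ → ℕ → Bool) → Set
IsTournament m b = (∀ i → i < m → b i i ≡ false)
                 × (∀ i j → i < m → j < m → i ≢ j → b i j ≡ not (b j i))

score : ℕ → (ℕ → ℕ → Bool) → ℕ → ℕ
score m b i = sumBelow m (λ j → bit (b i j))

-- each pair of vertices below k contributes exactly one arc
sumBelow-score≡C₂ : ∀ {m b} → IsTournament m b → ∀ k → k ≤ m →
                    sumBelow k (λ i → sumBelow k (λ j → bit (b i j))) ≡ C₂ k
sumBelow-score≡C₂ t zero    _     = refl
sumBelow-score≡C₂ {b = b} t@(irrefl , orient) (suc k) 1+k≤m = begin
  sumBelow (suc k) (λ i → sumBelow k (B i) + B i k)
    ≡⟨ sumBelow-+ (suc k) (λ i → sumBelow k (B i)) (λ i → B i k) ⟩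
  (sumBelow k (λ i → sumBelow k (B i)) + sumBelow k (B k)) + (sumBelow k (λ i → B i k) + B k k)
    ≡⟨ cong₂ (λ c d → (c + sumBelow k (B k)) + (sumBelow k (λ i → B i k) + d))
             (sumBelow-score≡C₂ t k (≤-trans (n≤1+n k) 1+k≤m)) (cong bit (irrefl k 1+k≤m)) ⟩
  (C₂ k + sumBelow k (B k)) + (sumBelow k (λ i → B i k) + 0)
    ≡⟨ regroup (C₂ k) (sumBelow k (B k)) (sumBelow k (λ i → B i k)) ⟩
  C₂ k + (sumBelow k (B k) + sumBelow k (λ i → B i k))
    ≡⟨ cong (C₂ k +_) (sym (sumBelow-+ k (B k) (λ i → B i k))) ⟩
  C₂ k + sumBelow k (λ j → B k j + B j k)
    ≡⟨ cong (C₂ k +_) (sumBelow-cong k one-winner) ⟩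
  C₂ k + sumBelow k (λ _ → 1)
    ≡⟨ cong (C₂ k +_) (trans (sumBelow-const k 1) (*-identityʳ k)) ⟩
  C₂ k + k ∎
  where
  open ≡-Reasoning
  B : ℕ → ℕ → ℕ
  B i j = bit (b i j)
  regroup : ∀ c x y → (c + x) + (y + 0) ≡ c + (x + y)
  regroup = solve-∀
  one-winner : ∀ j → j < k → B k j + B j k ≡ 1
  one-winner j j<k =
    trans (cong (λ c → bit c + B j k) (orient k j 1+k≤m (<-trans j<k 1+k≤m) (>⇒≢ j<k))) (bit-not (b j k))

sum-map-allFin : ∀ m (g : Fin m → ℕ) (h : ℕ → ℕ) → (∀ i → g i ≡ h (toℕ i)) →
                 sum (map g (allFin m)) ≡ sumBelow m h
sum-map-allFin m g h g≡h = trans (cong sum (List.map-tabulate id g)) (go m g h g≡h)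
  where
  go : ∀ m (g : Fin m → ℕ) h → (∀ i → g i ≡ h (toℕ i)) → sum (tabulate g) ≡ sumBelow m h
  go zero    g h g≡h = refl
  go (suc m) g h g≡h = trans (cong₂ _+_ (g≡h Fin.zero) (go m (g ∘ Fin.suc) (h ∘ suc) (g≡h ∘ Fin.suc)))
                             (sym (sumBelow-suc m h))

-- no arcs at vertices ≥ m
extend : ∀ {m} → Tournament m → ℕ → ℕ → Bool
extend {m} T i j with i <? m | j <? m
... | yes i<m | yes j<m = beats T (fromℕ< i<m) (fromℕ< j<m)
... | _       | _       = false

extend-fromℕ< : ∀ {m} (T : Tournament m) {i j} (i<m : i < m) (j<m : j < m) →
                extend T i j ≡ beats T (fromℕ< i<m) (fromℕ< j<m)
extend-fromℕ< {m} T {i} {j} i<m j<m with i <? m | j <? m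
... | yes _   | yes _   = refl
... | no i≮m  | _       = contradiction i<m i≮m
... | yes _   | no j≮m  = contradiction j<m j≮m

extend-toℕ : ∀ {m} (T : Tournament m) (i j : Fin m) → extend T (toℕ i) (toℕ j) ≡ beats T i j
extend-toℕ T i j = trans (extend-fromℕ< T (Fin.toℕ<n i) (Fin.toℕ<n j))
                         (cong₂ (beats T) (Fin.fromℕ<-toℕ i _) (Fin.fromℕ<-toℕ j _))

extend-isTournament : ∀ {m} (T : Tournament m) → IsTournament m (extend T)
extend-isTournament T =
  (λ i i<m → trans (extend-fromℕ< T i<m i<m) (irrefl T _)) ,
  (λ i j i<m j<m i≢j → trans (extend-fromℕ< T i<m j<m)
     (trans (orient T _ _ (λ e → i≢j (trans (sym (Fin.toℕ-fromℕ< i<m)) (trans (cong toℕ e) (Fin.toℕ-fromℕ< j<m)))))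
            (cong not (sym (extend-fromℕ< T j<m i<m)))))

outdeg≡score : ∀ {m} (T : Tournament m) i → outdeg T i ≡ score m (extend T) (toℕ i)
outdeg≡score {m} T i =
  sum-map-allFin m _ (λ j → bit (extend T (toℕ i) j)) (λ j → cong bit (sym (extend-toℕ T i j)))

restrict : ∀ {m b} → IsTournament m b → Tournament m
restrict {b = b} (irrefl′ , orient′) = record
  { beats  = λ i j → b (toℕ i) (toℕ j)
  ; irrefl = λ i → irrefl′ (toℕ i) (Fin.toℕ<n i)
  ; orient = λ i j i≢j → orient′ (toℕ i) (toℕ j) (Fin.toℕ<n i) (Fin.toℕ<n j) (i≢j ∘ Fin.toℕ-injective)
  }

outdeg-restrict : ∀ {m b} (t : IsTournament m b) i → outdeg (restrict t) i ≡ score m b (toℕ i)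
outdeg-restrict {m} {b} t i = sum-map-allFin m _ (λ j → bit (b (toℕ i) j)) (λ j → refl)

score-sequence⇒landau : ∀ xs → IsScoreSequence xs → IsLandau xs × sum xs ≡ C₂ (length xs)
score-sequence⇒landau xs (T , outdeg≡) = landau , total
  where
  m = length xs
  b = extend T
  t = extend-isTournament T
  score≡at : ∀ i → i < m → score m b i ≡ at xs i
  score≡at i i<m = begin
    score m b i                          ≡⟨ cong (λ i′ → score m b i′) (sym (Fin.toℕ-fromℕ< i<m)) ⟩
    score m b (toℕ (fromℕ< i<m))         ≡⟨ sym (outdeg≡score T (fromℕ< i<m)) ⟩
    outdeg T (fromℕ< i<m)                ≡⟨ outdeg≡ (fromℕ< i<m) ⟩
    lookup xs (fromℕ< i<m)               ≡⟨ lookup≡at xs (fromℕ< i<m) ⟩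
    at xs (toℕ (fromℕ< i<m))             ≡⟨ cong (at xs) (Fin.toℕ-fromℕ< i<m) ⟩
    at xs i                              ∎
    where open ≡-Reasoning
  landau : IsLandau xs
  landau k k≤m = subst (_≤ sumBelow k (at xs)) (sumBelow-score≡C₂ t k k≤m)
    (≤-trans (sumBelow-mono k (λ i _ → sumBelow-monoˡ (λ j → bit (b i j)) k≤m))
             (≤-reflexive (sumBelow-cong k (λ i i<k → score≡at i (<-≤-trans i<k k≤m)))))
  total : sum xs ≡ C₂ m
  total = trans (sym (sumBelow-at xs)) (trans (sym (sumBelow-cong m score≡at)) (sumBelow-score≡C₂ t m ≤-refl))

≡ᵇ-refl : ∀ i → (i ≡ᵇ i) ≡ true
≡ᵇ-refl zero    = refl
≡ᵇ-refl (suc i) = ≡ᵇ-refl i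

≡ᵇ-true⇒≡ : ∀ {i j} → (i ≡ᵇ j) ≡ true → i ≡ j
≡ᵇ-true⇒≡ {i} {j} e = ≡ᵇ⇒≡ i j (Equivalence.from T-≡ e)

≢⇒≡ᵇ-false : ∀ {i j} → i ≢ j → (i ≡ᵇ j) ≡ false
≢⇒≡ᵇ-false {i} {j} i≢j with i ≡ᵇ j in eq
... | true  = contradiction (≡ᵇ-true⇒≡ eq) i≢j
... | false = refl

<⇒<ᵇ-true : ∀ {i j} → i < j → (i <ᵇ j) ≡ true
<⇒<ᵇ-true {i} {j} i<j with i <ᵇ j | <⇒<ᵇ i<j
... | true | _ = refl

≤⇒<ᵇ-false : ∀ {i j} → j ≤ i → (i <ᵇ j) ≡ false
≤⇒<ᵇ-false {i} {j} j≤i with i <ᵇ j in eq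
... | true  = contradiction j≤i (<⇒≱ (<ᵇ⇒< i j (Equivalence.from T-≡ eq)))
... | false = refl

transitive : ℕ → ℕ → Bool
transitive i j = j <ᵇ i

transitive-isTournament : ∀ m → IsTournament m transitive
transitive-isTournament m = (λ i _ → ≤⇒<ᵇ-false {i} ≤-refl) , orientation
  where
  orientation : ∀ i j → i < m → j < m → i ≢ j → transitive i j ≡ not (transitive j i)
  orientation i j _ _ i≢j with <-cmp i j
  ... | tri< i<j _ _ = trans (≤⇒<ᵇ-false (<⇒≤ i<j)) (cong not (sym (<⇒<ᵇ-true i<j)))
  ... | tri≈ _ i≡j _ = contradiction i≡j i≢j
  ... | tri> _ _ j<i = trans (<⇒<ᵇ-true j<i) (cong not (sym (≤⇒<ᵇ-false (<⇒≤ j<i))))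

score-transitive : ∀ m i → score m transitive i ≡ m ⊓ i
score-transitive zero    i = refl
score-transitive (suc m) i with m <? i
... | yes m<i = begin
  score m transitive i + bit (m <ᵇ i) ≡⟨ cong₂ (λ c d → c + bit d) (score-transitive m i) (<⇒<ᵇ-true m<i) ⟩
  m ⊓ i + 1                           ≡⟨ cong (_+ 1) (m≤n⇒m⊓n≡m (<⇒≤ m<i)) ⟩
  m + 1                               ≡⟨ +-comm m 1 ⟩
  suc m                               ≡⟨ sym (m≤n⇒m⊓n≡m m<i) ⟩
  suc m ⊓ i                           ∎
  where open ≡-Reasoning
... | no m≮i = begin
  score m transitive i + bit (m <ᵇ i) ≡⟨ cong₂ (λ c d → c + bit d) (score-transitive m i) (≤⇒<ᵇ-false i≤m) ⟩
  m ⊓ i + 0                           ≡⟨ +-identityʳ _ ⟩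
  m ⊓ i                               ≡⟨ m≥n⇒m⊓n≡n i≤m ⟩
  i                                   ≡⟨ sym (m≥n⇒m⊓n≡n (m≤n⇒m≤1+n i≤m)) ⟩
  suc m ⊓ i                           ∎
  where
  open ≡-Reasoning
  i≤m : i ≤ m
  i≤m = ≮⇒≥ m≮i

sumBelow-update : ∀ k f g y → y < k → (∀ j → j < k → j ≢ y → f j ≡ g j) →
                  sumBelow k f + g y ≡ sumBelow k g + f y
sumBelow-update (suc k) f g y y<1+k f≡g with y ≟ k
... | yes refl = begin
  sumBelow k f + f k + g k   ≡⟨ cong (λ c → c + f k + g k) (sumBelow-cong k (λ j j<k → f≡g j (m<n⇒m<1+n j<k) (<⇒≢ j<k))) ⟩
  sumBelow k g + f k + g k   ≡⟨ xy∙z≈xz∙y (sumBelow k g) (f k) (g k) ⟩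
  sumBelow k g + g k + f k   ∎
  where open ≡-Reasoning
... | no y≢k = begin
  sumBelow k f + f k + g y   ≡⟨ xy∙z≈xz∙y (sumBelow k f) (f k) (g y) ⟩
  sumBelow k f + g y + f k   ≡⟨ cong₂ _+_ (sumBelow-update k f g y (≤∧≢⇒< (≤-pred y<1+k) y≢k) (λ j j<k → f≡g j (m<n⇒m<1+n j<k)))
                                          (f≡g k ≤-refl (≢-sym y≢k)) ⟩
  sumBelow k g + f y + g k   ≡⟨ xy∙z≈xz∙y (sumBelow k g) (f y) (g k) ⟩
  sumBelow k g + g k + f y   ∎
  where open ≡-Reasoning

isArc : ℕ → ℕ → ℕ → ℕ → Bool
isArc u v i j = ((i ≡ᵇ u) ∧ (j ≡ᵇ v)) ∨ ((i ≡ᵇ v) ∧ (j ≡ᵇ u))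

isArc-sym : ∀ u v i j → isArc u v i j ≡ isArc u v j i
isArc-sym u v i j = trans (∨-comm ((i ≡ᵇ u) ∧ (j ≡ᵇ v)) _) (cong₂ _∨_ (∧-comm (i ≡ᵇ v) (j ≡ᵇ u)) (∧-comm (i ≡ᵇ u) (j ≡ᵇ v)))

isArc-forward : ∀ u v → isArc u v u v ≡ true
isArc-forward u v rewrite ≡ᵇ-refl u | ≡ᵇ-refl v = refl

isArc-backward : ∀ u v → isArc u v v u ≡ true
isArc-backward u v = trans (isArc-sym u v v u) (isArc-forward u v)

isArc-false : ∀ {u v i j} → i ≢ u ⊎ j ≢ v → i ≢ v ⊎ j ≢ u → isArc u v i j ≡ false
isArc-false p q = cong₂ _∨_ (∧≡false p) (∧≡false q)
  where
  ∧≡false : ∀ {i j k l} → i ≢ k ⊎ j ≢ l → ((i ≡ᵇ k) ∧ (j ≡ᵇ l)) ≡ false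
  ∧≡false (inj₁ i≢k) rewrite ≢⇒≡ᵇ-false i≢k = refl
  ∧≡false {i} {k = k} (inj₂ j≢l) rewrite ≢⇒≡ᵇ-false j≢l = ∧-zeroʳ (i ≡ᵇ k)

isArc-diagonal : ∀ {u v} i → u ≢ v → isArc u v i i ≡ false
isArc-diagonal {u} i u≢v with i ≟ u
... | yes refl = isArc-false (inj₂ u≢v) (inj₁ u≢v)
... | no i≢u   = isArc-false (inj₁ i≢u) (inj₂ i≢u)

reverseArc : ℕ → ℕ → (ℕ → ℕ → Bool) → ℕ → ℕ → Bool
reverseArc u v b i j = if isArc u v i j then not (b i j) else b i j

reverseArc-on : ∀ {u v i j} b → isArc u v i j ≡ true → reverseArc u v b i j ≡ not (b i j)
reverseArc-on b e rewrite e = refl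

reverseArc-off : ∀ {u v i j} b → isArc u v i j ≡ false → reverseArc u v b i j ≡ b i j
reverseArc-off b e rewrite e = refl

reverseArc-isTournament : ∀ {m u v b} → u ≢ v → IsTournament m b → IsTournament m (reverseArc u v b)
reverseArc-isTournament {m} {u} {v} {b} u≢v (irrefl , orient) = irrefl′ , orient′
  where
  irrefl′ : ∀ i → i < m → reverseArc u v b i i ≡ false
  irrefl′ i i<m = trans (reverseArc-off b (isArc-diagonal i u≢v)) (irrefl i i<m)
  orient′ : ∀ i j → i < m → j < m → i ≢ j → reverseArc u v b i j ≡ not (reverseArc u v b j i)
  orient′ i j i<m j<m i≢j = by-cases (isArc u v i j) refl
    where
    by-cases : ∀ c → isArc u v i j ≡ c → reverseArc u v b i j ≡ not (reverseArc u v b j i)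
    by-cases true  e = trans (reverseArc-on b e) (cong not (trans (orient i j i<m j<m i≢j)
                         (sym (reverseArc-on b (trans (sym (isArc-sym u v i j)) e)))))
    by-cases false e = trans (reverseArc-off b e) (trans (orient i j i<m j<m i≢j)
                         (cong not (sym (reverseArc-off b (trans (sym (isArc-sym u v i j)) e)))))

arc⇒≢ : ∀ {m b u v} → IsTournament m b → u < m → b u v ≡ true → u ≢ v
arc⇒≢ (irrefl , _) u<m buv refl with trans (sym buv) (irrefl _ u<m)
... | ()

record ScoreTransfer (m : ℕ) (b : ℕ → ℕ → Bool) (u v : ℕ) : Set where
  field
    tournament   : ℕ → ℕ → Bool
    isTournament : IsTournament m tournament
    score-from   : suc (score m tournament u) ≡ score m b u
    score-to     : score m tournament v ≡ suc (score m b v)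
    score-other  : ∀ i → i ≢ u → i ≢ v → score m tournament i ≡ score m b i

reverseArc-transfer : ∀ {m b u v} → IsTournament m b → u < m → v < m → b u v ≡ true → ScoreTransfer m b u v
reverseArc-transfer {m} {b} {u} {v} t@(_ , orient) u<m v<m buv = record
  { tournament   = b′
  ; isTournament = reverseArc-isTournament u≢v t
  ; score-from   = from
  ; score-to     = to
  ; score-other  = λ i i≢u i≢v →
      sumBelow-cong m (λ j _ → cong bit (reverseArc-off b (isArc-false {j = j} (inj₁ i≢u) (inj₁ i≢v))))
  }
  where
  open ≡-Reasoning
  b′ = reverseArc u v b
  u≢v : u ≢ v
  u≢v = arc⇒≢ t u<m buv
  bvu : b v u ≡ false
  bvu = trans (orient v u v<m u<m (≢-sym u≢v)) (cong not buv)
  from : suc (score m b′ u) ≡ score m b u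
  from = begin
    suc (score m b′ u)              ≡⟨ +-comm 1 _ ⟩
    score m b′ u + 1                ≡⟨ cong (λ c → score m b′ u + bit c) buv ⟨
    score m b′ u + bit (b u v)      ≡⟨ sumBelow-update m _ _ v v<m (λ j _ j≢v →
                                         cong bit (reverseArc-off b (isArc-false (inj₂ j≢v) (inj₁ u≢v)))) ⟩
    score m b u + bit (b′ u v)      ≡⟨ cong (λ c → score m b u + bit c) (trans (reverseArc-on b (isArc-forward u v)) (cong not buv)) ⟩
    score m b u + 0                 ≡⟨ +-identityʳ _ ⟩
    score m b u                     ∎
  to : score m b′ v ≡ suc (score m b v)
  to = begin
    score m b′ v                    ≡⟨ +-identityʳ _ ⟨
    score m b′ v + 0                ≡⟨ cong (λ c → score m b′ v + bit c) bvu ⟨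
    score m b′ v + bit (b v u)      ≡⟨ sumBelow-update m _ _ u u<m (λ j _ j≢u →
                                         cong bit (reverseArc-off b (isArc-false (inj₁ (≢-sym u≢v)) (inj₂ j≢u)))) ⟩
    score m b v + bit (b′ v u)      ≡⟨ cong (λ c → score m b v + bit c) (trans (reverseArc-on b (isArc-backward u v)) (cong not bvu)) ⟩
    score m b v + 1                 ≡⟨ +-comm _ 1 ⟩
    suc (score m b v)               ∎

transfer-trans : ∀ {m b u w v} → u ≢ w → w ≢ v → u ≢ v → (t₁ : ScoreTransfer m b u w) →
                 ScoreTransfer m (ScoreTransfer.tournament t₁) w v → ScoreTransfer m b u v
transfer-trans {m} {b} {u} {w} {v} u≢w w≢v u≢v t₁ t₂ = record
  { tournament   = T₂.tournament
  ; isTournament = T₂.isTournament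
  ; score-from   = trans (cong suc (T₂.score-other u u≢w u≢v)) T₁.score-from
  ; score-to     = trans T₂.score-to (cong suc (T₁.score-other v (≢-sym u≢v) (≢-sym w≢v)))
  ; score-other  = other
  }
  where
  module T₁ = ScoreTransfer t₁
  module T₂ = ScoreTransfer t₂
  other : ∀ i → i ≢ u → i ≢ v → score m T₂.tournament i ≡ score m b i
  other i i≢u i≢v with i ≟ w
  ... | yes refl = suc-injective (trans T₂.score-from T₁.score-to)
  ... | no i≢w   = trans (T₂.score-other i i≢w i≢v) (T₁.score-other i i≢u i≢w)

-- v beats u and everything u beats
no-2-path⇒score< : ∀ {m b u v} → IsTournament m b → u < m → v < m → u ≢ v → b u v ≡ false →
                   (∀ w → w < m → b u w ≡ true → b w v ≡ false) → score m b u < score m b v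
no-2-path⇒score< {m} {b} {u} {v} (irrefl , orient) u<m v<m u≢v buv no-path =
  sumBelow-mono-< m pointwise u u<m strict
  where
  bvu : b v u ≡ true
  bvu = trans (orient v u v<m u<m (≢-sym u≢v)) (cong not buv)
  strict : bit (b u u) < bit (b v u)
  strict rewrite irrefl u u<m | bvu = ≤-refl
  pointwise : ∀ j → j < m → bit (b u j) ≤ bit (b v j)
  pointwise j j<m with b u j in buj
  ... | false = z≤n
  ... | true  = ≤-reflexive (cong bit (sym bvj))
    where
    j≢v : j ≢ v
    j≢v refl with trans (sym buj) buv
    ... | ()
    bvj : b v j ≡ true
    bvj = trans (orient v j v<m j<m (≢-sym j≢v)) (cong not (no-path j j<m buj))

least-below : ∀ {P : ℕ → Set} → Decidable P → ∀ N →
              (∃ λ k → k < N × P k × (∀ j → j < k → ¬ P j)) ⊎ (∀ k → k < N → ¬ P k)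
least-below P? zero = inj₂ (λ _ ())
least-below {P} P? (suc N) with least-below P? N
... | inj₁ (k , k<N , pk , minimal) = inj₁ (k , m<n⇒m<1+n k<N , pk , minimal)
... | inj₂ none with P? N
...   | yes pN = inj₁ (N , ≤-refl , pN , none)
...   | no ¬pN = inj₂ none′
  where
  none′ : ∀ k → k < suc N → ¬ P k
  none′ k k<1+N with m<1+n⇒m<n∨m≡n k<1+N
  ... | inj₁ k<N  = none k k<N
  ... | inj₂ refl = ¬pN

-- reverse an arc u → v or a path u → w → v; if there is neither, v dominates u
transfer : ∀ {m b u v} → IsTournament m b → u < m → v < m → u ≢ v →
           score m b v ≤ score m b u → ScoreTransfer m b u v
transfer {m} {b} {u} {v} t u<m v<m u≢v sv≤su with b u v in buv
... | true  = reverseArc-transfer t u<m v<m buv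
... | false with least-below (λ w → (b u w Bool.≟ true) ×-dec (b w v Bool.≟ true)) m
...   | inj₂ none = contradiction sv≤su (<⇒≱ (no-2-path⇒score< t u<m v<m u≢v buv
                      (λ w w<m buw → ¬-not (λ bwv → none w w<m (buw , bwv)))))
...   | inj₁ (w , w<m , (buw , bwv) , _) =
  transfer-trans u≢w w≢v u≢v first (reverseArc-transfer (ScoreTransfer.isTournament first) w<m v<m bwv′)
  where
  u≢w : u ≢ w
  u≢w = arc⇒≢ t u<m buw
  w≢v : w ≢ v
  w≢v = arc⇒≢ t w<m bwv
  first : ScoreTransfer m b u w
  first = reverseArc-transfer t u<m w<m buw
  bwv′ : reverseArc u w b w v ≡ true
  bwv′ = trans (reverseArc-off b (isArc-false (inj₁ (≢-sym u≢w)) (inj₂ (≢-sym u≢v)))) bwv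

moveUnit : ℕ → ℕ → (ℕ → ℕ) → ℕ → ℕ
moveUnit a b s i = if i ≡ᵇ a then pred (s i) else if i ≡ᵇ b then suc (s i) else s i

moveUnit-from : ∀ a b s → moveUnit a b s a ≡ pred (s a)
moveUnit-from a b s rewrite ≡ᵇ-refl a = refl

moveUnit-to : ∀ {a b} s → b ≢ a → moveUnit a b s b ≡ suc (s b)
moveUnit-to {b = b} s b≢a rewrite ≢⇒≡ᵇ-false b≢a | ≡ᵇ-refl b = refl

moveUnit-other : ∀ {a b i} s → i ≢ a → i ≢ b → moveUnit a b s i ≡ s i
moveUnit-other s i≢a i≢b rewrite ≢⇒≡ᵇ-false i≢a | ≢⇒≡ᵇ-false i≢b = refl

⟦_<_⟧ : ℕ → ℕ → ℕ
⟦ x < k ⟧ = bit (x <ᵇ k)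

⟦<⟧-true : ∀ {x k} → x < k → ⟦ x < k ⟧ ≡ 1
⟦<⟧-true x<k rewrite <⇒<ᵇ-true x<k = refl

⟦<⟧-false : ∀ {x k} → k ≤ x → ⟦ x < k ⟧ ≡ 0
⟦<⟧-false k≤x rewrite ≤⇒<ᵇ-false k≤x = refl

⟦<⟧-suc : ∀ {x k} → k ≢ x → ⟦ x < suc k ⟧ ≡ ⟦ x < k ⟧
⟦<⟧-suc {x} {k} k≢x with x <? k
... | yes x<k = trans (⟦<⟧-true (m<n⇒m<1+n x<k)) (sym (⟦<⟧-true x<k))
... | no x≮k  = trans (⟦<⟧-false (≤∧≢⇒< (≮⇒≥ x≮k) k≢x)) (sym (⟦<⟧-false (≮⇒≥ x≮k)))

-- moving a unit from position a to position b > a lowers exactly the prefix sums S_k with a < k ≤ b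
sumBelow-moveUnit : ∀ {a b s} → a < b → 1 ≤ s a →
                    ∀ k → sumBelow k (moveUnit a b s) + ⟦ a < k ⟧ ≡ sumBelow k s + ⟦ b < k ⟧
sumBelow-moveUnit a<b 1≤sa zero = refl
sumBelow-moveUnit {a} {b} {s} a<b 1≤sa (suc k) with k ≟ a | k ≟ b
... | yes refl | _ = begin
  S′ + s′ k + ⟦ k < suc k ⟧         ≡⟨ cong₂ (λ c d → S′ + c + d) (moveUnit-from a b s) (⟦<⟧-true (n<1+n k)) ⟩
  S′ + pred (s k) + 1               ≡⟨ +-assoc S′ (pred (s k)) 1 ⟩
  S′ + (pred (s k) + 1)             ≡⟨ cong₂ _+_ S′≡S (trans (+-comm (pred (s k)) 1) (suc-pred (s k) {{>-nonZero 1≤sa}})) ⟩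
  S + s k                           ≡⟨ +-identityʳ _ ⟨
  S + s k + 0                       ≡⟨ cong (S + s k +_) (⟦<⟧-false a<b) ⟨
  S + s k + ⟦ b < suc k ⟧           ∎
  where
  open ≡-Reasoning
  s′ = moveUnit a b s
  S′ = sumBelow k s′
  S  = sumBelow k s
  S′≡S : S′ ≡ S
  S′≡S = +-cancelʳ-≡ 0 S′ S (trans (cong (S′ +_) (sym (⟦<⟧-false {k} ≤-refl)))
           (trans (sumBelow-moveUnit a<b 1≤sa k) (cong (S +_) (⟦<⟧-false (<⇒≤ a<b)))))
... | no k≢a | yes refl = begin
  S′ + s′ k + ⟦ a < suc k ⟧         ≡⟨ cong₂ (λ c d → S′ + c + d) (moveUnit-to s k≢a) (⟦<⟧-true (m<n⇒m<1+n a<b)) ⟩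
  S′ + suc (s k) + 1                ≡⟨ regroup S′ (s k) ⟩
  (S′ + 1) + s k + 1                ≡⟨ cong (λ c → c + s k + 1) S′+1≡S ⟩
  S + s k + 1                       ≡⟨ cong (S + s k +_) (⟦<⟧-true (n<1+n k)) ⟨
  S + s k + ⟦ k < suc k ⟧           ∎
  where
  open ≡-Reasoning
  s′ = moveUnit a b s
  S′ = sumBelow k s′
  S  = sumBelow k s
  regroup : ∀ c d → c + suc d + 1 ≡ (c + 1) + d + 1
  regroup = solve-∀
  S′+1≡S : S′ + 1 ≡ S
  S′+1≡S = trans (cong (S′ +_) (sym (⟦<⟧-true a<b)))
             (trans (sumBelow-moveUnit a<b 1≤sa k) (trans (cong (S +_) (⟦<⟧-false {k} ≤-refl)) (+-identityʳ S)))
... | no k≢a | no k≢b = begin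
  S′ + s′ k + ⟦ a < suc k ⟧         ≡⟨ cong₂ (λ c d → S′ + c + d) (moveUnit-other s k≢a k≢b) (⟦<⟧-suc k≢a) ⟩
  S′ + s k + ⟦ a < k ⟧              ≡⟨ xy∙z≈xz∙y S′ (s k) _ ⟩
  S′ + ⟦ a < k ⟧ + s k              ≡⟨ cong (_+ s k) (sumBelow-moveUnit a<b 1≤sa k) ⟩
  S + ⟦ b < k ⟧ + s k               ≡⟨ xy∙z≈xz∙y S _ (s k) ⟩
  S + s k + ⟦ b < k ⟧               ≡⟨ cong (S + s k +_) (⟦<⟧-suc k≢b) ⟨
  S + s k + ⟦ b < suc k ⟧           ∎
  where
  open ≡-Reasoning
  s′ = moveUnit a b s
  S′ = sumBelow k s′
  S  = sumBelow k s

sumBelow-moveUnit-outside : ∀ {a b s} → a < b → 1 ≤ s a → ∀ k → k ≤ a ⊎ b < k →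
                            sumBelow k (moveUnit a b s) ≡ sumBelow k s
sumBelow-moveUnit-outside {a} {b} {s} a<b 1≤sa k outside = +-cancelʳ-≡ ⟦ a < k ⟧ S′ S
  (trans (sumBelow-moveUnit a<b 1≤sa k) (cong (S +_) (same-side outside)))
  where
  S′ = sumBelow k (moveUnit a b s)
  S  = sumBelow k s
  same-side : k ≤ a ⊎ b < k → ⟦ b < k ⟧ ≡ ⟦ a < k ⟧
  same-side (inj₁ k≤a) = trans (⟦<⟧-false (≤-trans k≤a (<⇒≤ a<b))) (sym (⟦<⟧-false k≤a))
  same-side (inj₂ b<k) = trans (⟦<⟧-true b<k) (sym (⟦<⟧-true (<-trans a<b b<k)))

sumBelow-moveUnit-inside : ∀ {a b s} → a < b → 1 ≤ s a → ∀ k → a < k → k ≤ b →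
                           suc (sumBelow k (moveUnit a b s)) ≡ sumBelow k s
sumBelow-moveUnit-inside {a} {b} {s} a<b 1≤sa k a<k k≤b = begin
  suc S′                 ≡⟨ +-comm 1 S′ ⟩
  S′ + 1                 ≡⟨ cong (S′ +_) (⟦<⟧-true a<k) ⟨
  S′ + ⟦ a < k ⟧         ≡⟨ sumBelow-moveUnit a<b 1≤sa k ⟩
  S + ⟦ b < k ⟧          ≡⟨ cong (S +_) (⟦<⟧-false k≤b) ⟩
  S + 0                  ≡⟨ +-identityʳ S ⟩
  S                      ∎
  where
  open ≡-Reasoning
  S′ = sumBelow k (moveUnit a b s)
  S  = sumBelow k s

record StrictRun (m : ℕ) (s : ℕ → ℕ) : Set where
  field
    a b     : ℕ
    a<b     : a < b
    b<m     : b < m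
    tight-a : sumBelow a s ≡ C₂ a
    tight-b : sumBelow (suc b) s ≡ C₂ (suc b)
    slack   : ∀ k → a < k → k ≤ b → C₂ k < sumBelow k s

strictRun-or-identity : ∀ {m s} → LandauBounds m s → sumBelow m s ≡ C₂ m →
                        StrictRun m s ⊎ (∀ i → i < m → s i ≡ i)
strictRun-or-identity {m} {s} landau total with least-below (λ k → C₂ k <? sumBelow k s) (suc m)
... | inj₂ none = inj₂ s≡id
  where
  tight : ∀ k → k ≤ m → sumBelow k s ≡ C₂ k
  tight k k≤m = ≤-antisym (≮⇒≥ (none k (s≤s k≤m))) (landau k k≤m)
  s≡id : ∀ i → i < m → s i ≡ i
  s≡id i i<m = +-cancelˡ-≡ (C₂ i) (s i) i
    (trans (cong (_+ s i) (sym (tight i (<⇒≤ i<m)))) (tight (suc i) i<m))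
... | inj₁ (zero , _ , () , _)
... | inj₁ (suc a , 1+a<1+m , slack-1+a , minimal)
  with least-below (λ k → (a <? k) ×-dec (sumBelow k s ≟ C₂ k)) (suc m)
...   | inj₂ none = contradiction (≤-pred 1+a<1+m , total) (none m ≤-refl)
...   | inj₁ (zero , _ , (() , _) , _)
...   | inj₁ (suc b , 1+b<1+m , (a<1+b , tight-1+b) , minimal′) = inj₁ record
  { a       = a
  ; b       = b
  ; a<b     = a<b
  ; b<m     = ≤-pred 1+b<1+m
  ; tight-a = ≤-antisym (≮⇒≥ (minimal a (n<1+n a))) (landau a (≤-trans (n≤1+n a) (≤-pred 1+a<1+m)))
  ; tight-b = tight-1+b
  ; slack   = slack
  }
  where
  a<b : a < b
  a<b = ≤∧≢⇒< (≤-pred a<1+b) λ { refl → <-irrefl (sym tight-1+b) slack-1+a }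
  slack : ∀ k → a < k → k ≤ b → C₂ k < sumBelow k s
  slack k a<k k≤b = ≤∧≢⇒< (landau k (≤-trans k≤b (<⇒≤ (≤-pred 1+b<1+m))))
                          (λ eq → minimal′ k (s≤s k≤b) (a<k , sym eq))

potential : ℕ → (ℕ → ℕ) → ℕ
potential m s = sumBelow (suc m) (λ k → sumBelow k s)

Realisation : ℕ → (ℕ → ℕ) → Set
Realisation m s = Σ (ℕ → ℕ → Bool) λ b → IsTournament m b × (∀ i → i < m → score m b i ≡ s i)

module MoveAlongRun {m s} (run : StrictRun m s) (sorted : Sorted m s)
                    (landau : LandauBounds m s) (total : sumBelow m s ≡ C₂ m) where
  open StrictRun run

  s′ : ℕ → ℕ
  s′ = moveUnit a b s

  b≢a : b ≢ a
  b≢a = >⇒≢ a<b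

  a<sa : a < s a
  a<sa = +-cancelˡ-< (C₂ a) a (s a) (subst (C₂ a + a <_) (cong (_+ s a) tight-a) (slack (suc a) ≤-refl a<b))

  1≤sa : 1 ≤ s a
  1≤sa = ≤-trans (s≤s z≤n) a<sa

  s-before-a : ∀ {a₀} → a ≡ suc a₀ → s a₀ ≤ a₀
  s-before-a {a₀} refl = +-cancelˡ-≤ (sumBelow a₀ s) (s a₀) a₀
    (≤-trans (≤-reflexive tight-a) (+-monoˡ-≤ a₀ (landau a₀ (<⇒≤ (<-trans (n<1+n a₀) (<-trans a<b b<m))))))

  sb<b : s b < b
  sb<b = +-cancelˡ-< (sumBelow b s) (s b) b
    (≤-trans (≤-reflexive (cong suc tight-b)) (+-monoˡ-≤ b (slack b a<b ≤-refl)))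

  s-after-b : suc (suc b) ≤ m → suc b ≤ s (suc b)
  s-after-b 2+b≤m = +-cancelˡ-≤ (C₂ (suc b)) (suc b) (s (suc b))
    (subst (C₂ (suc b) + suc b ≤_) (cong (_+ s (suc b)) tight-b) (landau (suc (suc b)) 2+b≤m))

  s′≤s : ∀ i → i ≢ b → s′ i ≤ s i
  s′≤s i i≢b with i ≟ a
  ... | yes refl = ≤-trans (≤-reflexive (moveUnit-from a b s)) pred[n]≤n
  ... | no i≢a   = ≤-reflexive (moveUnit-other s i≢a i≢b)

  s≤s′ : ∀ i → i ≢ a → s i ≤ s′ i
  s≤s′ i i≢a with i ≟ b
  ... | yes refl = ≤-trans (n≤1+n (s i)) (≤-reflexive (sym (moveUnit-to s b≢a)))
  ... | no i≢b   = ≤-reflexive (sym (moveUnit-other s i≢a i≢b))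

  sorted′ : Sorted m s′
  sorted′ i 1+i<m with i ≟ b | suc i ≟ a
  ... | yes refl | _ = begin
    s′ i              ≡⟨ moveUnit-to s b≢a ⟩
    suc (s i)         ≤⟨ m<n⇒m<1+n sb<b ⟩
    suc i             ≤⟨ s-after-b 1+i<m ⟩
    s (suc i)         ≤⟨ s≤s′ (suc i) (λ e → <-irrefl (sym e) (<-trans a<b (n<1+n b))) ⟩
    s′ (suc i)        ∎
    where open ≤-Reasoning
  ... | no i≢b | yes refl = begin
    s′ i              ≤⟨ s′≤s i i≢b ⟩
    s i               ≤⟨ s-before-a refl ⟩
    i                 <⟨ n<1+n i ⟩
    suc i             ≤⟨ pred-mono-≤ a<sa ⟩
    pred (s (suc i))  ≡⟨ moveUnit-from (suc i) b s ⟨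
    s′ (suc i)        ∎
    where open ≤-Reasoning
  ... | no i≢b | no 1+i≢a = ≤-trans (s′≤s i i≢b) (≤-trans (sorted i 1+i<m) (s≤s′ (suc i) 1+i≢a))

  sumBelow-s′ : ∀ k → sumBelow k s′ ≤ sumBelow k s
  sumBelow-s′ k with a <? k | k ≤? b
  ... | yes a<k | yes k≤b = ≤-trans (n≤1+n _) (≤-reflexive (sumBelow-moveUnit-inside a<b 1≤sa k a<k k≤b))
  ... | no a≮k  | _       = ≤-reflexive (sumBelow-moveUnit-outside a<b 1≤sa k (inj₁ (≮⇒≥ a≮k)))
  ... | yes _   | no k≰b  = ≤-reflexive (sumBelow-moveUnit-outside a<b 1≤sa k (inj₂ (≰⇒> k≰b)))

  landau′ : LandauBounds m s′
  landau′ k k≤m with a <? k | k ≤? b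
  ... | yes a<k | yes k≤b = ≤-pred (subst (C₂ k <_) (sym (sumBelow-moveUnit-inside a<b 1≤sa k a<k k≤b)) (slack k a<k k≤b))
  ... | no a≮k  | _       = subst (C₂ k ≤_) (sym (sumBelow-moveUnit-outside a<b 1≤sa k (inj₁ (≮⇒≥ a≮k)))) (landau k k≤m)
  ... | yes _   | no k≰b  = subst (C₂ k ≤_) (sym (sumBelow-moveUnit-outside a<b 1≤sa k (inj₂ (≰⇒> k≰b)))) (landau k k≤m)

  total′ : sumBelow m s′ ≡ C₂ m
  total′ = trans (sumBelow-moveUnit-outside a<b 1≤sa m (inj₂ b<m)) total

  potential-decreases : potential m s′ < potential m s
  potential-decreases = sumBelow-mono-< (suc m) (λ k _ → sumBelow-s′ k) b (m<n⇒m<1+n b<m)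
    (≤-reflexive (sumBelow-moveUnit-inside a<b 1≤sa b a<b ≤-refl))

  realisation : Realisation m s′ → Realisation m s
  realisation (t , isT , score≡s′) = T.tournament , T.isTournament , score≡s
    where
    s′a≤s′b : s′ a ≤ s′ b
    s′a≤s′b = begin
      s′ a        ≡⟨ moveUnit-from a b s ⟩
      pred (s a)  ≤⟨ pred[n]≤n ⟩
      s a         ≤⟨ Sorted⇒monotone sorted (<⇒≤ a<b) b<m ⟩
      s b         ≤⟨ n≤1+n (s b) ⟩
      suc (s b)   ≡⟨ moveUnit-to s b≢a ⟨
      s′ b        ∎
      where open ≤-Reasoning
    a<m : a < m
    a<m = <-trans a<b b<m
    module T = ScoreTransfer (transfer isT b<m a<m b≢a
                 (subst₂ _≤_ (sym (score≡s′ a a<m)) (sym (score≡s′ b b<m)) s′a≤s′b))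
    score≡s : ∀ i → i < m → score m T.tournament i ≡ s i
    score≡s i i<m with i ≟ b | i ≟ a
    ... | yes refl | _        = suc-injective (trans T.score-from (trans (score≡s′ i i<m) (moveUnit-to s b≢a)))
    ... | no i≢b   | yes refl = trans T.score-to (trans (cong suc (trans (score≡s′ i i<m) (moveUnit-from a b s)))
                                  (suc-pred (s i) {{>-nonZero 1≤sa}}))
    ... | no i≢b   | no i≢a   = trans (T.score-other i i≢b i≢a) (trans (score≡s′ i i<m) (moveUnit-other s i≢a i≢b))

realise : ∀ m s → Sorted m s → LandauBounds m s → sumBelow m s ≡ C₂ m → Realisation m s
realise m s = go s (<-wellFounded (potential m s))
  where
  go : ∀ s → Acc _<_ (potential m s) → Sorted m s → LandauBounds m s → sumBelow m s ≡ C₂ m → Realisation m s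
  go s (acc rec) sorted landau total with strictRun-or-identity landau total
  ... | inj₂ s≡id = transitive , transitive-isTournament m , λ i i<m →
    trans (score-transitive m i) (trans (m≥n⇒m⊓n≡n (<⇒≤ i<m)) (sym (s≡id i i<m)))
  ... | inj₁ run = realisation (go s′ (rec potential-decreases) sorted′ landau′ total′)
    where open MoveAlongRun run sorted landau total

landau⇒score-sequence : ∀ xs → IsSorted xs → IsLandau xs → sum xs ≡ C₂ (length xs) → IsScoreSequence xs
landau⇒score-sequence xs sorted landau total = restrict isT , λ i →
  trans (outdeg-restrict isT i) (trans (score≡ (toℕ i) (Fin.toℕ<n i)) (sym (lookup≡at xs i)))
  where
  m = length xs
  r : Realisation m (at xs)
  r = realise m (at xs) sorted landau (trans (sumBelow-at xs) total)
  isT = proj₁ (proj₂ r)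
  score≡ = proj₂ (proj₂ r)

-- C₂ is convex, so Landau's bound at both ends of a linear stretch implies it in between
C₂-chord : ∀ P Q a y z → C₂ P ≤ Q → C₂ (P + (y + z)) ≤ Q + (y + z) * a → C₂ (P + y) ≤ Q + y * a
C₂-chord P Q a zero    z left right = subst₂ (λ p q → C₂ p ≤ q) (sym (+-identityʳ P)) (sym (+-identityʳ Q)) left
C₂-chord P Q a (suc y) z left right = square≤⇒C₂≤ (P + suc y) (Q + suc y * a) (m+n≤o⇒m≤o _ middle)
  where
  w = suc y + z
  combined : z * (P * P) + suc y * ((P + w) * (P + w)) ≤ z * (2 * Q + P) + suc y * (2 * (Q + w * a) + (P + w))
  combined = +-mono-≤ (*-monoʳ-≤ z (C₂≤⇒square≤ P Q left)) (*-monoʳ-≤ (suc y) (C₂≤⇒square≤ (P + w) (Q + w * a) right))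
  lhs : ∀ P y z → z * (P * P) + suc y * ((P + (suc y + z)) * (P + (suc y + z)))
                ≡ (suc y + z) * ((P + suc y) * (P + suc y) + suc y * z)
  lhs = solve-∀
  rhs : ∀ P Q a y z → z * (2 * Q + P) + suc y * (2 * (Q + (suc y + z) * a) + (P + (suc y + z)))
                    ≡ (suc y + z) * (2 * (Q + suc y * a) + (P + suc y))
  rhs = solve-∀
  middle : (P + suc y) * (P + suc y) + suc y * z ≤ 2 * (Q + suc y * a) + (P + suc y)
  middle = *-cancelˡ-≤ w (subst₂ _≤_ (lhs P y z) (rhs P Q a y z) combined)

++-replicate-landau : ∀ xs x a → IsLandau xs → C₂ (length xs + x) ≤ sum xs + x * a →
                      IsLandau (xs ++ replicate x a)
++-replicate-landau xs x a landau end k k≤len = by-cases (k ≤? n)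
  where
  n = length xs
  ys = xs ++ replicate x a
  sumBelow-prefix : ∀ k → k ≤ n → sumBelow k (at ys) ≡ sumBelow k (at xs)
  sumBelow-prefix k k≤n = sumBelow-cong k (λ i i<k → at-++ˡ xs (replicate x a) i (<-≤-trans i<k k≤n))
  sumBelow-block : ∀ y → y ≤ x → sumBelow (n + y) (at ys) ≡ sum xs + y * a
  sumBelow-block y y≤x = begin
    sumBelow (n + y) (at ys)                                   ≡⟨ sumBelow-split n y (at ys) ⟩
    sumBelow n (at ys) + sumBelow y (λ i → at ys (n + i))      ≡⟨ cong₂ _+_ (trans (sumBelow-prefix n ≤-refl) (sumBelow-at xs))
                                                                   (sumBelow-cong y (λ i i<y → trans (at-++ʳ xs (replicate x a) i)
                                                                                                     (at-replicate x a i (<-≤-trans i<y y≤x)))) ⟩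
    sum xs + sumBelow y (λ _ → a)                              ≡⟨ cong (sum xs +_) (sumBelow-const y a) ⟩
    sum xs + y * a                                             ∎
    where open ≡-Reasoning
  block : ∀ y → y ≤ x → C₂ (n + y) ≤ sumBelow (n + y) (at ys)
  block y y≤x = subst (C₂ (n + y) ≤_) (sym (sumBelow-block y y≤x))
    (C₂-chord n (sum xs) a y (x ∸ y) (IsLandau⇒C₂≤sum xs landau)
      (subst (λ w → C₂ (n + w) ≤ sum xs + w * a) (sym (m+[n∸m]≡n y≤x)) end))
  k∸n≤x : k ∸ n ≤ x
  k∸n≤x = subst (k ∸ n ≤_) (m+n∸m≡n n x) (∸-monoˡ-≤ n (subst (k ≤_) (length-++-replicate xs x a) k≤len))
  by-cases : Dec (k ≤ n) → C₂ k ≤ sumBelow k (at ys)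
  by-cases (yes k≤n) = subst (C₂ k ≤_) (sym (sumBelow-prefix k k≤n)) (landau k k≤n)
  by-cases (no k≰n)  = subst (λ k → C₂ k ≤ sumBelow k (at ys)) (m+[n∸m]≡n (<⇒≤ (≰⇒> k≰n))) (block (k ∸ n) k∸n≤x)

++-replicate-bounded : ∀ xs c x a → BoundedBy c xs → c ≤ a → BoundedBy a (xs ++ replicate x a)
++-replicate-bounded xs c x a bounded c≤a i i<len with i <? length xs
... | yes i<n = subst (_≤ a) (sym (at-++ˡ xs (replicate x a) i i<n)) (≤-trans (bounded i i<n) c≤a)
... | no i≮n  = ≤-reflexive (at-++-replicate xs x a i (≮⇒≥ i≮n) (subst (i <_) (length-++-replicate xs x a) i<len))

++-replicate-sorted : ∀ xs c x a → IsSorted xs → BoundedBy c xs → c ≤ a → IsSorted (xs ++ replicate x a)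
++-replicate-sorted xs c x a sorted bounded c≤a i 1+i<len with suc i <? length xs
... | yes 1+i<n = subst₂ _≤_ (sym (at-++ˡ xs (replicate x a) i (<-trans (n<1+n i) 1+i<n)))
                              (sym (at-++ˡ xs (replicate x a) (suc i) 1+i<n)) (sorted i 1+i<n)
... | no 1+i≮n  = subst (at (xs ++ replicate x a) i ≤_)
                        (sym (at-++-replicate xs x a (suc i) (≮⇒≥ 1+i≮n) (subst (suc i <_) (length-++-replicate xs x a) 1+i<len)))
                        (++-replicate-bounded xs c x a bounded c≤a i (<-trans (n<1+n i) 1+i<len))

-- The bound B(p', q', a)

square-injective : ∀ {x y} → x * x ≡ y * y → x ≡ y
square-injective {x} {y} eq with <-cmp x y
... | tri< x<y _ _ = contradiction eq (<⇒≢ (*-mono-< x<y x<y))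
... | tri≈ _ x≡y _ = x≡y
... | tri> _ _ y<x = contradiction (sym eq) (<⇒≢ (*-mono-< y<x y<x))

-- exactSqrt is a linear search by a function local to its definition;
-- sqrtSearch is that function, recovered by unification in exactSqrt-unfold
mutual
  sqrtSearch : ℕ → List ℕ → Maybe ℕ
  sqrtSearch = _

  exactSqrt-unfold : ∀ d → exactSqrt d ≡ (if 0 ≡ᵇ d then just 0 else sqrtSearch d (applyUpTo suc d))
  exactSqrt-unfold d with applyUpTo suc d
  ... | xs = refl

sqrtSearch-sound : ∀ d ys {s} → sqrtSearch d ys ≡ just s → s * s ≡ d
sqrtSearch-sound d (y ∷ ys) e with y * y ≡ᵇ d in found
sqrtSearch-sound d (y ∷ ys) refl | true  = ≡ᵇ-true⇒≡ found
sqrtSearch-sound d (y ∷ ys) e    | false = sqrtSearch-sound d ys e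

sqrtSearch-complete : ∀ d ys {s} → s * s ≡ d → s ∈ ys → sqrtSearch d ys ≡ just s
sqrtSearch-complete d (y ∷ ys) {s} s²≡d s∈ with y * y ≡ᵇ d in found
... | true = cong just (square-injective (trans (≡ᵇ-true⇒≡ found) (sym s²≡d)))
... | false with s∈
...   | here refl = contradiction (trans (sym found) (Equivalence.to T-≡ (≡⇒≡ᵇ (y * y) d s²≡d))) λ ()
...   | there s∈ys = sqrtSearch-complete d ys s²≡d s∈ys

exactSqrt-sound : ∀ {d s} → exactSqrt d ≡ just s → s * s ≡ d
exactSqrt-sound {d} e = sqrtSearch-sound d (0 ∷ applyUpTo suc d) (trans (sym (exactSqrt-unfold d)) e)

exactSqrt-square : ∀ s → exactSqrt (s * s) ≡ just s
exactSqrt-square s = trans (exactSqrt-unfold (s * s))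
  (sqrtSearch-complete (s * s) (0 ∷ applyUpTo suc (s * s)) refl (Membership.∈-upTo⁺ (s≤s (n≤n*n s))))
  where
  n≤n*n : ∀ n → n ≤ n * n
  n≤n*n zero    = z≤n
  n≤n*n (suc n) = m≤m*n (suc n) (suc n)

n*[n∸1]≡2*C₂ : ∀ n → n * (n ∸ 1) ≡ 2 * C₂ n
n*[n∸1]≡2*C₂ zero    = refl
n*[n∸1]≡2*C₂ (suc n) = begin
  n + n * n              ≡⟨ cong (n +_) (2*C₂+n≡n*n n) ⟨
  n + (2 * C₂ n + n)     ≡⟨ regroup n (C₂ n) ⟩
  2 * (C₂ n + n)         ∎
  where
  open ≡-Reasoning
  regroup : ∀ n c → n + (2 * c + n) ≡ 2 * (c + n)
  regroup = solve-∀

C₂-+-bound : ∀ p q a x → C₂ p ≤ q → x + p ≤ a → C₂ (p + x) ≤ q + x * a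
C₂-+-bound p q a x C₂p≤q x+p≤a = begin
  C₂ (p + x)                 ≡⟨ C₂-+ p x ⟩
  C₂ p + p * x + C₂ x        ≤⟨ +-mono-≤ (+-monoˡ-≤ (p * x) C₂p≤q) (C₂≤square x) ⟩
  q + p * x + x * x          ≡⟨ regroup q p x ⟩
  q + x * (x + p)            ≤⟨ +-monoʳ-≤ q (*-monoʳ-≤ x x+p≤a) ⟩
  q + x * a                  ∎
  where
  open ≤-Reasoning
  regroup : ∀ q p x → q + p * x + x * x ≡ q + x * (x + p)
  regroup = solve-∀

C₂-+≡⇒a<t+p : ∀ p q a t → 1 ≤ t → C₂ p ≤ q → C₂ (p + t) ≡ q + t * a → a < t + p
C₂-+≡⇒a<t+p p q a t 1≤t C₂p≤q tight with a <? t + p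
... | yes a<t+p = a<t+p
... | no a≮t+p  = contradiction tight (<⇒≢ (begin-strict
  C₂ (p + t)                 ≡⟨ C₂-+ p t ⟩
  C₂ p + p * t + C₂ t        <⟨ +-mono-≤-< (+-monoˡ-≤ (p * t) C₂p≤q) (C₂<square 1≤t) ⟩
  q + p * t + t * t          ≡⟨ regroup q p t ⟩
  q + t * (t + p)            ≤⟨ +-monoʳ-≤ q (*-monoʳ-≤ t (≮⇒≥ a≮t+p)) ⟩
  q + t * a                  ∎))
  where
  open ≤-Reasoning
  regroup : ∀ q p x → q + p * x + x * x ≡ q + x * (x + p)
  regroup = solve-∀

2*[1+n]≡1+[2*n+1] : ∀ a → 2 * suc a ≡ suc (2 * a + 1)
2*[1+n]≡1+[2*n+1] = solve-∀

halve-≤ : ∀ n a → 2 * n ≤ 2 * a + 1 → n ≤ a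
halve-≤ n a 2n≤2a+1 = ≤-pred (*-cancelˡ-< 2 n (suc a) (≤-trans (s≤s 2n≤2a+1) (≤-reflexive (sym (2*[1+n]≡1+[2*n+1] a)))))

module _ where
  open import Data.Integer using (+_)

  ℤ-+-cancelˡ-≤ : ∀ i {j k} → i ℤ.+ j ℤ.≤ i ℤ.+ k → j ℤ.≤ k
  ℤ-+-cancelˡ-≤ i {j} {k} le = subst₂ ℤ._≤_ (sub-add i j) (sub-add i k) (ℤₚ.+-monoʳ-≤ (ℤ.- i) le)
    where
    sub-add : ∀ i j → ℤ.- i ℤ.+ (i ℤ.+ j) ≡ j
    sub-add = ℤ-Ring.solve-∀

  exchange-≤ : ∀ {i j k l} → i ℤ.+ j ≡ k ℤ.+ l → (k ℤ.≤ i ⇔ j ℤ.≤ l)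
  exchange-≤ {i} {j} {k} eq = mk⇔
    (λ k≤i → ℤ-+-cancelˡ-≤ k (subst (k ℤ.+ j ℤ.≤_) eq (ℤₚ.+-monoˡ-≤ j k≤i)))
    (λ j≤l → ℤ-+-cancelˡ-≤ j (subst₂ ℤ._≤_ (ℤₚ.+-comm k j) (trans (sym eq) (ℤₚ.+-comm i j)) (ℤₚ.+-monoʳ-≤ k j≤l)))

  square-nonneg : ∀ i → + 0 ℤ.≤ i ℤ.* i
  square-nonneg (+ n)      = subst (+ 0 ℤ.≤_) (ℤₚ.pos-* n n) (+≤+ z≤n)
  square-nonneg ℤ.-[1+ n ] = +≤+ z≤n

  8*C₂≡ : ∀ k → + (8 * C₂ k) ≡ + 4 ℤ.* (+ k ℤ.* + k) ℤ.- + 4 ℤ.* + k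
  8*C₂≡ k = begin
    + (8 * C₂ k)                                  ≡⟨ add-sub (+ (8 * C₂ k)) (+ (4 * k)) ⟨
    (+ (8 * C₂ k) ℤ.+ + (4 * k)) ℤ.- + (4 * k)    ≡⟨ cong (ℤ._- + (4 * k)) (ℤₚ.pos-+ (8 * C₂ k) (4 * k)) ⟨
    + (8 * C₂ k + 4 * k) ℤ.- + (4 * k)            ≡⟨ cong (λ n → + n ℤ.- + (4 * k)) (trans (regroup (C₂ k) k) (cong (4 *_) (2*C₂+n≡n*n k))) ⟩
    + (4 * (k * k)) ℤ.- + (4 * k)                 ≡⟨ cong₂ ℤ._-_ (trans (ℤₚ.pos-* 4 (k * k)) (cong (+ 4 ℤ.*_) (ℤₚ.pos-* k k))) (ℤₚ.pos-* 4 k) ⟩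
    + 4 ℤ.* (+ k ℤ.* + k) ℤ.- + 4 ℤ.* + k         ∎
    where
    open ≡-Reasoning
    add-sub : ∀ i k → (i ℤ.+ k) ℤ.- k ≡ i
    add-sub = ℤ-Ring.solve-∀
    regroup : ∀ c k → 8 * c + 4 * k ≡ 4 * (2 * c + k)
    regroup = solve-∀

  hB≡ : ∀ p a → hB p a ≡ (+ 2 ℤ.* + a ℤ.+ + 1) ℤ.- + 2 ℤ.* + p
  hB≡ p a = cong₂ ℤ._-_ (trans (ℤₚ.pos-+ (2 * a) 1) (cong (ℤ._+ + 1) (ℤₚ.pos-* 2 a))) (ℤₚ.pos-* 2 p)

  -- x ≤ B(p', q', a) iff 2x - h ≤ 0 or (2x - h)² ≤ disc
  yB : ℕ → ℕ → ℕ → ℤ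
  yB p a x = + (2 * x) ℤ.- hB p a

  -- completing the square in C(p'+x, 2) ≤ q' + x a
  discB-identity : ∀ p q a x → discB p q a ℤ.+ + (8 * C₂ (p + x)) ≡ yB p a x ℤ.* yB p a x ℤ.+ + (8 * (q + x * a))
  discB-identity p q a x = begin
    discB p q a ℤ.+ + (8 * C₂ (p + x))
      ≡⟨ cong₂ ℤ._+_ disc (trans (8*C₂≡ (p + x)) (cong (λ k → + 4 ℤ.* (k ℤ.* k) ℤ.- + 4 ℤ.* k) (ℤₚ.pos-+ p x))) ⟩
    (H ℤ.* H ℤ.+ + 8 ℤ.* Q ℤ.- (+ 4 ℤ.* (P ℤ.* P) ℤ.- + 4 ℤ.* P))
      ℤ.+ (+ 4 ℤ.* ((P ℤ.+ X) ℤ.* (P ℤ.+ X)) ℤ.- + 4 ℤ.* (P ℤ.+ X))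
      ≡⟨ complete-square P Q α′ X ⟩
    (+ 2 ℤ.* X ℤ.- H) ℤ.* (+ 2 ℤ.* X ℤ.- H) ℤ.+ + 8 ℤ.* (Q ℤ.+ X ℤ.* α′)
      ≡⟨ cong₂ ℤ._+_ (cong₂ ℤ._*_ y≡ y≡) rhs ⟨
    yB p a x ℤ.* yB p a x ℤ.+ + (8 * (q + x * a)) ∎
    where
    open ≡-Reasoning
    P = + p
    Q = + q
    α′ = + a
    X = + x
    H = (+ 2 ℤ.* α′ ℤ.+ + 1) ℤ.- + 2 ℤ.* P
    disc : discB p q a ≡ H ℤ.* H ℤ.+ + 8 ℤ.* Q ℤ.- (+ 4 ℤ.* (P ℤ.* P) ℤ.- + 4 ℤ.* P)
    disc = cong₂ ℤ._-_ (cong₂ ℤ._+_ (cong₂ ℤ._*_ (hB≡ p a) (hB≡ p a)) (ℤₚ.pos-* 8 q))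
      (trans (cong (λ n → + (4 * n)) (n*[n∸1]≡2*C₂ p)) (trans (cong +_ (sym (*-assoc 4 2 (C₂ p)))) (8*C₂≡ p)))
    y≡ : yB p a x ≡ + 2 ℤ.* X ℤ.- H
    y≡ = cong₂ ℤ._-_ (ℤₚ.pos-* 2 x) (hB≡ p a)
    rhs : + (8 * (q + x * a)) ≡ + 8 ℤ.* (Q ℤ.+ X ℤ.* α′)
    rhs = trans (ℤₚ.pos-* 8 (q + x * a)) (cong (+ 8 ℤ.*_) (trans (ℤₚ.pos-+ q (x * a)) (cong (λ z → Q ℤ.+ z) (ℤₚ.pos-* x a))))
    complete-square : ∀ P Q α X → let H = (+ 2 ℤ.* α ℤ.+ + 1) ℤ.- + 2 ℤ.* P in
      (H ℤ.* H ℤ.+ + 8 ℤ.* Q ℤ.- (+ 4 ℤ.* (P ℤ.* P) ℤ.- + 4 ℤ.* P))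
        ℤ.+ (+ 4 ℤ.* ((P ℤ.+ X) ℤ.* (P ℤ.+ X)) ℤ.- + 4 ℤ.* (P ℤ.+ X))
      ≡ (+ 2 ℤ.* X ℤ.- H) ℤ.* (+ 2 ℤ.* X ℤ.- H) ℤ.+ + 8 ℤ.* (Q ℤ.+ X ℤ.* α)
    complete-square = ℤ-Ring.solve-∀

  leB-complete : ∀ p q a x → C₂ (p + x) ≤ q + x * a → leB p q a x ≡ true
  leB-complete p q a x bound =
    Equivalence.to T-≡ (Equivalence.from T-∧ (ℤₚ.≤⇒≤ᵇ 0≤d , Equivalence.from T-∨ (inj₂ (ℤₚ.≤⇒≤ᵇ y²≤d))))
    where
    y²≤d : yB p a x ℤ.* yB p a x ℤ.≤ discB p q a
    y²≤d = Equivalence.from (exchange-≤ (discB-identity p q a x)) (+≤+ (*-monoʳ-≤ 8 bound))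
    0≤d : + 0 ℤ.≤ discB p q a
    0≤d = ℤₚ.≤-trans (square-nonneg (yB p a x)) y²≤d

  leB⇒ : ∀ p q a x → leB p q a x ≡ true → yB p a x ℤ.≤ + 0 ⊎ yB p a x ℤ.* yB p a x ℤ.≤ discB p q a
  leB⇒ p q a x e = Sum.map ℤₚ.≤ᵇ⇒≤ ℤₚ.≤ᵇ⇒≤
    (Equivalence.to T-∨ (proj₂ (Equivalence.to (T-∧ {+ 0 ℤ.≤ᵇ discB p q a}) (Equivalence.from T-≡ e))))

  leB-sound : ∀ p q a x → C₂ p ≤ q → leB p q a x ≡ true → C₂ (p + x) ≤ q + x * a
  leB-sound p q a x C₂p≤q e with leB⇒ p q a x e
  ... | inj₂ y²≤d = *-cancelˡ-≤ {C₂ (p + x)} {q + x * a} 8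
                      (ℤₚ.drop‿+≤+ (Equivalence.to (exchange-≤ (discB-identity p q a x)) y²≤d))
  ... | inj₁ y≤0  = C₂-+-bound p q a x C₂p≤q x+p≤a
    where
    shift : yB p a x ℤ.+ + (2 * a + 1) ≡ + (2 * x + 2 * p)
    shift = trans (sub-sub-add (+ (2 * x)) (+ (2 * a + 1)) (+ (2 * p))) (sym (ℤₚ.pos-+ (2 * x) (2 * p)))
      where
      sub-sub-add : ∀ u v w → (u ℤ.- (v ℤ.- w)) ℤ.+ v ≡ u ℤ.+ w
      sub-sub-add = ℤ-Ring.solve-∀
    2x+2p≤2a+1 : + (2 * x + 2 * p) ℤ.≤ + (2 * a + 1)
    2x+2p≤2a+1 = subst₂ ℤ._≤_ shift (ℤₚ.+-identityˡ _) (ℤₚ.+-monoˡ-≤ (+ (2 * a + 1)) y≤0)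
    x+p≤a : x + p ≤ a
    x+p≤a = halve-≤ (x + p) a (subst (_≤ 2 * a + 1) (sym (*-distribˡ-+ 2 x p)) (ℤₚ.drop‿+≤+ 2x+2p≤2a+1))

  if-just : ∀ c {A : Set} {x y : A} {m : Maybe A} → (if c then just x else m) ≡ just y →
            (c ≡ true × x ≡ y) ⊎ (c ≡ false × m ≡ just y)
  if-just true  refl = inj₁ (refl , refl)
  if-just false e    = inj₂ (refl , e)

  halve-check : ∀ u t → u ≡ + (t * 2) → 1 ≤ t →
                (if (+ 2 ℤ.≤ᵇ u) ∧ ((ℤ.∣ u ∣ % 2) ≡ᵇ 0) then just (ℤ.∣ u ∣ / 2) else nothing) ≡ just t
  halve-check _ t refl 1≤t = trans (if-true (cong₂ _∧_ 2≤2t even)) (cong just (m*n/n≡m t 2))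
    where
    if-true : ∀ {c} {A : Set} {x y : A} → c ≡ true → (if c then x else y) ≡ x
    if-true refl = refl
    2≤2t : (+ 2 ℤ.≤ᵇ + (t * 2)) ≡ true
    2≤2t = Equivalence.to T-≡ (ℤₚ.≤⇒≤ᵇ (+≤+ (*-monoˡ-≤ 2 1≤t)))
    even : ((t * 2) % 2 ≡ᵇ 0) ≡ true
    even = cong (_≡ᵇ 0) (m*n%n≡0 t 2)

  intB≡just⇒ : ∀ p q a t → intB p q a ≡ just t → 1 ≤ t × discB p q a ≡ yB p a t ℤ.* yB p a t
  intB≡just⇒ p q a t e with + 0 ℤ.≤ᵇ discB p q a in 0≤ᵇd
  intB≡just⇒ p q a t () | false
  intB≡just⇒ p q a t e  | true with exactSqrt ℤ.∣ discB p q a ∣ in root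
  intB≡just⇒ p q a t () | true | nothing
  intB≡just⇒ p q a t e  | true | just s with if-just ((+ 2 ℤ.≤ᵇ (+ s ℤ.+ hB p a)) ∧ ((ℤ.∣ + s ℤ.+ hB p a ∣ % 2) ≡ᵇ 0)) e
  ... | inj₂ (_ , ())
  ... | inj₁ (checks , halved) = 1≤t , d≡y²
    where
    u = + s ℤ.+ hB p a
    2≤u : + 2 ℤ.≤ u
    2≤u = ℤₚ.≤ᵇ⇒≤ (proj₁ (Equivalence.to T-∧ (Equivalence.from T-≡ checks)))
    even : ℤ.∣ u ∣ % 2 ≡ 0
    even = ≡ᵇ⇒≡ _ 0 (proj₂ (Equivalence.to (T-∧ {+ 2 ℤ.≤ᵇ u}) (Equivalence.from T-≡ checks)))
    u≡2t : u ≡ + (t * 2)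
    u≡2t = trans (sym (ℤₚ.0≤i⇒+∣i∣≡i (ℤₚ.≤-trans (+≤+ z≤n) 2≤u)))
                 (cong +_ (trans (m≡m%n+[m/n]*n ℤ.∣ u ∣ 2) (cong₂ (λ r k → r + k * 2) even halved)))
    1≤t : 1 ≤ t
    1≤t = *-cancelʳ-≤ 1 t 2 (ℤₚ.drop‿+≤+ (subst (+ 2 ℤ.≤_) u≡2t 2≤u))
    y≡s : yB p a t ≡ + s
    y≡s = begin
      + (2 * t) ℤ.- hB p a       ≡⟨ cong (λ n → + n ℤ.- hB p a) (*-comm 2 t) ⟩
      + (t * 2) ℤ.- hB p a       ≡⟨ cong (ℤ._- hB p a) u≡2t ⟨
      u ℤ.- hB p a               ≡⟨ add-sub (+ s) (hB p a) ⟩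
      + s                        ∎
      where
      open ≡-Reasoning
      add-sub : ∀ i k → (i ℤ.+ k) ℤ.- k ≡ i
      add-sub = ℤ-Ring.solve-∀
    d≡y² : discB p q a ≡ yB p a t ℤ.* yB p a t
    d≡y² = begin
      discB p q a                ≡⟨ ℤₚ.0≤i⇒+∣i∣≡i (ℤₚ.≤ᵇ⇒≤ (Equivalence.from T-≡ 0≤ᵇd)) ⟨
      + ℤ.∣ discB p q a ∣        ≡⟨ cong +_ (exactSqrt-sound root) ⟨
      + (s * s)                  ≡⟨ ℤₚ.pos-* s s ⟩
      + s ℤ.* + s                ≡⟨ cong₂ ℤ._*_ y≡s y≡s ⟨
      yB p a t ℤ.* yB p a t      ∎
      where open ≡-Reasoning

  ⇒intB≡just : ∀ p q a t s → 1 ≤ t → yB p a t ≡ + s → discB p q a ≡ + (s * s) → intB p q a ≡ just t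
  ⇒intB≡just p q a t s 1≤t y≡s d≡s² with + 0 ℤ.≤ᵇ discB p q a in 0≤ᵇd
  ... | false = contradiction (trans (sym 0≤ᵇd) (Equivalence.to T-≡ (ℤₚ.≤⇒≤ᵇ (subst (+ 0 ℤ.≤_) (sym d≡s²) (+≤+ z≤n))))) λ ()
  ... | true with exactSqrt ℤ.∣ discB p q a ∣ in root
  ...   | nothing = contradiction (trans (sym root) (trans (cong (λ d → exactSqrt ℤ.∣ d ∣) d≡s²) (exactSqrt-square s))) λ ()
  ...   | just s′ = halve-check (+ s′ ℤ.+ hB p a) t u≡2t 1≤t
    where
    s′≡s : s′ ≡ s
    s′≡s = just-injective (trans (sym root) (trans (cong (λ d → exactSqrt ℤ.∣ d ∣) d≡s²) (exactSqrt-square s)))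
    u≡2t : + s′ ℤ.+ hB p a ≡ + (t * 2)
    u≡2t = begin
      + s′ ℤ.+ hB p a                        ≡⟨ cong (λ n → + n ℤ.+ hB p a) s′≡s ⟩
      + s ℤ.+ hB p a                         ≡⟨ cong (ℤ._+ hB p a) y≡s ⟨
      (+ (2 * t) ℤ.- hB p a) ℤ.+ hB p a      ≡⟨ sub-add (+ (2 * t)) (hB p a) ⟩
      + (2 * t)                              ≡⟨ cong +_ (*-comm 2 t) ⟩
      + (t * 2)                              ∎
      where
      open ≡-Reasoning
      sub-add : ∀ i k → (i ℤ.- k) ℤ.+ k ≡ i
      sub-add = ℤ-Ring.solve-∀

  intB-sound : ∀ p q a t → intB p q a ≡ just t → 1 ≤ t × C₂ (p + t) ≡ q + t * a
  intB-sound p q a t e with intB≡just⇒ p q a t e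
  ... | 1≤t , d≡y² = 1≤t , *-cancelˡ-≡ (C₂ (p + t)) (q + t * a) 8 (ℤₚ.+-injective (∙-cancelˡ (yB p a t ℤ.* yB p a t) _ _ eq))
    where
    eq : yB p a t ℤ.* yB p a t ℤ.+ + (8 * C₂ (p + t)) ≡ yB p a t ℤ.* yB p a t ℤ.+ + (8 * (q + t * a))
    eq = trans (cong (ℤ._+ + (8 * C₂ (p + t))) (sym d≡y²)) (discB-identity p q a t)

  intB-complete : ∀ p q a t → 1 ≤ t → C₂ p ≤ q → C₂ (p + t) ≡ q + t * a → intB p q a ≡ just t
  intB-complete p q a t 1≤t C₂p≤q tight = ⇒intB≡just p q a t s 1≤t y≡s d≡s²
    where
    2a+1≤2t+2p : 2 * a + 1 ≤ 2 * t + 2 * p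
    2a+1≤2t+2p = ≤-trans (n≤1+n _) (subst₂ _≤_ (2*[1+n]≡1+[2*n+1] a) (*-distribˡ-+ 2 t p)
                   (*-monoʳ-≤ 2 (C₂-+≡⇒a<t+p p q a t 1≤t C₂p≤q tight)))
    s = (2 * t + 2 * p) ∸ (2 * a + 1)
    y≡s : yB p a t ≡ + s
    y≡s = begin
      + (2 * t) ℤ.- (+ (2 * a + 1) ℤ.- + (2 * p))   ≡⟨ regroup (+ (2 * t)) (+ (2 * a + 1)) (+ (2 * p)) ⟩
      (+ (2 * t) ℤ.+ + (2 * p)) ℤ.- + (2 * a + 1)   ≡⟨ cong (ℤ._- + (2 * a + 1)) (ℤₚ.pos-+ (2 * t) (2 * p)) ⟨
      + (2 * t + 2 * p) ℤ.- + (2 * a + 1)           ≡⟨ ℤₚ.[+m]-[+n]≡m⊖n (2 * t + 2 * p) (2 * a + 1) ⟩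
      (2 * t + 2 * p) ℤ.⊖ (2 * a + 1)               ≡⟨ ℤₚ.⊖-≥ 2a+1≤2t+2p ⟩
      + s                                           ∎
      where
      open ≡-Reasoning
      regroup : ∀ u v w → u ℤ.- (v ℤ.- w) ≡ (u ℤ.+ w) ℤ.- v
      regroup = ℤ-Ring.solve-∀
    balanced : discB p q a ℤ.+ + (8 * C₂ (p + t)) ≡ yB p a t ℤ.* yB p a t ℤ.+ + (8 * C₂ (p + t))
    balanced = trans (discB-identity p q a t) (cong (λ n → yB p a t ℤ.* yB p a t ℤ.+ + (8 * n)) (sym tight))
    d≡s² : discB p q a ≡ + (s * s)
    d≡s² = begin
      discB p q a                  ≡⟨ ∙-cancelʳ (+ (8 * C₂ (p + t))) _ _ balanced ⟩
      yB p a t ℤ.* yB p a t        ≡⟨ cong₂ ℤ._*_ y≡s y≡s ⟩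
      + s ℤ.* + s                  ≡⟨ ℤₚ.pos-* s s ⟨
      + (s * s)                    ∎
      where open ≡-Reasoning

-- The tables L_ℓ

Filled : Table → ℕ → ℕ → Set
Filled L p q = is-just (L p q) ≡ true

Filled⇒just : ∀ {L p q} → Filled L p q → Σ Triple λ t → L p q ≡ just t
Filled⇒just {L} {p} {q} filled with L p q
... | just t = t , refl

foldl-preserves : ∀ {A B : Set} (P : A → Set) (f : A → B → A) {z} xs →
                  (∀ a y → y ∈ xs → P a → P (f a y)) → P z → P (foldl f z xs)
foldl-preserves P f []       pres pz = pz
foldl-preserves P f (x ∷ xs) pres pz = foldl-preserves P f xs (λ a y y∈ → pres a y (there y∈)) (pres _ x (here refl) pz)

foldl-establishes : ∀ {A B : Set} (P : A → Set) (f : A → B → A) {z} xs {y} → y ∈ xs →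
                    (∀ a → P (f a y)) → (∀ a y′ → P a → P (f a y′)) → P (foldl f z xs)
foldl-establishes P f (x ∷ xs) (here refl) est pres = foldl-preserves P f xs (λ a y′ _ → pres a y′) (est _)
foldl-establishes P f (x ∷ xs) (there y∈)  est pres = foldl-establishes P f xs y∈ est pres

insertIfEmpty-just : ∀ {p q t L a b t′} → insertIfEmpty p q t L a b ≡ just t′ →
                     L a b ≡ just t′ ⊎ (a ≡ p × b ≡ q × t ≡ t′)
insertIfEmpty-just {p} {q} {L = L} {a} {b} e with (a ≡ᵇ p) in a≡p | (b ≡ᵇ q) in b≡q | is-nothing (L p q)
... | true  | true  | true  = inj₂ (≡ᵇ-true⇒≡ a≡p , ≡ᵇ-true⇒≡ b≡q , just-injective e)
... | true  | true  | false = inj₁ e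
... | true  | false | _     = inj₁ e
... | false | _     | _     = inj₁ e

insertIfEmpty-keeps : ∀ p q t L {a b} → Filled L a b → Filled (insertIfEmpty p q t L) a b
insertIfEmpty-keeps p q t L {a} {b} filled with (a ≡ᵇ p) ∧ (b ≡ᵇ q) ∧ is-nothing (L p q)
... | true  = refl
... | false = filled

insertIfEmpty-fills : ∀ p q t L → Filled (insertIfEmpty p q t L) p q
insertIfEmpty-fills p q t L rewrite ≡ᵇ-refl p | ≡ᵇ-refl q with L p q
... | just _  = refl
... | nothing = refl

-- definitionally the local step function of buildLevel
firstStep : Table → ℕ → ℕ → Table → ℕ × ℕ → Table
firstStep Lprev a x L (p′ , q′) =
  if is-just (Lprev p′ q′) ∧ leB p′ q′ a x then insertIfEmpty (p′ + x) (q′ + x * a) (p′ , q′ , x) L else L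

FirstPartEntry : Table → ℕ → ℕ → ℕ → Triple → Set
FirstPartEntry Lprev a p q (p′ , q′ , x) =
  Filled Lprev p′ q′ × leB p′ q′ a x ≡ true × 1 ≤ x × p ≡ p′ + x × q ≡ q′ + x * a

Stores : (ℕ → ℕ → Triple → Set) → Table → Set
Stores G L = ∀ p q t → L p q ≡ just t → G p q t

firstStep-stores : ∀ Lprev a x L y → 1 ≤ x →
                   Stores (FirstPartEntry Lprev a) L → Stores (FirstPartEntry Lprev a) (firstStep Lprev a x L y)
firstStep-stores Lprev a x L (p′ , q′) 1≤x stored p q t e with is-just (Lprev p′ q′) in filled | leB p′ q′ a x in passes
... | false | _     = stored p q t e
... | true  | false = stored p q t e
... | true  | true with insertIfEmpty-just {p′ + x} {q′ + x * a} {p′ , q′ , x} {L} e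
...   | inj₁ old                 = stored p q t old
...   | inj₂ (refl , refl , refl) = filled , passes , 1≤x , refl , refl

buildLevel-sound : ∀ α ord ℓ Lprev → Stores (FirstPartEntry Lprev (A α ℓ)) (buildLevel α ord ℓ Lprev)
buildLevel-sound α ord ℓ Lprev =
  foldl-preserves (Stores G) _ xs
    (λ L x x∈ stored → foldl-preserves (Stores G) _ (ord ℓ x)
       (λ L′ y _ → firstStep-stores Lprev (A α ℓ) x L′ y (1≤ x∈)) stored)
    (λ _ _ _ ())
  where
  G = FirstPartEntry Lprev (A α ℓ)
  xs = map suc (upTo (2 * A α ℓ + 1))
  1≤ : ∀ {x} → x ∈ xs → 1 ≤ x
  1≤ x∈ with Membership.∈-map⁻ suc x∈
  ... | _ , _ , refl = s≤s z≤n

firstStep-keeps : ∀ Lprev a x L y {u v} → Filled L u v → Filled (firstStep Lprev a x L y) u v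
firstStep-keeps Lprev a x L (p′ , q′) filled with is-just (Lprev p′ q′) ∧ leB p′ q′ a x
... | true  = insertIfEmpty-keeps (p′ + x) (q′ + x * a) (p′ , q′ , x) L filled
... | false = filled

buildLevel-complete : ∀ α ord ℓ Lprev {x p′ q′} → 1 ≤ x → x ≤ 2 * A α ℓ + 1 → (p′ , q′) ∈ ord ℓ x →
                      Filled Lprev p′ q′ → leB p′ q′ (A α ℓ) x ≡ true →
                      Filled (buildLevel α ord ℓ Lprev) (p′ + x) (q′ + x * A α ℓ)
buildLevel-complete α ord ℓ Lprev {suc x} {p′} {q′} _ x<bound p′q′∈ filled passes =
  foldl-establishes P _ (map suc (upTo (2 * A α ℓ + 1))) (Membership.∈-map⁺ suc (Membership.∈-upTo⁺ x<bound))
    (λ L → foldl-establishes P _ (ord ℓ (suc x)) p′q′∈ fill (λ L′ y → firstStep-keeps Lprev a (suc x) L′ y))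
    (λ L x′ filled′ → foldl-preserves P _ (ord ℓ x′) (λ L′ y _ → firstStep-keeps Lprev a x′ L′ y) filled′)
  where
  a = A α ℓ
  P : Table → Set
  P L = Filled L (p′ + suc x) (q′ + suc x * a)
  fill : ∀ L → P (firstStep Lprev a (suc x) L (p′ , q′))
  fill L rewrite filled | passes = insertIfEmpty-fills (p′ + suc x) (q′ + suc x * a) (p′ , q′ , suc x) L

-- secondPart folds a step function local to its definition;
-- secondStep is that function, recovered by unification in secondPart-unfold
mutual
  secondStep : (ℕ → ℕ) → Order → List (ℕ × ℕ) → ℕ → Table → ℕ × ℕ → Table
  secondStep = _

  secondPart-unfold : ∀ α ord ordF n → secondPart α ord ordF n ≡ foldl (secondStep α ord ordF n) (λ _ _ → nothing) ordF
  secondPart-unfold α ord ordF n = refl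

SecondPartEntry : Table → ℕ → ℕ → ℕ → Triple → Set
SecondPartEntry Lprev a p q (p′ , q′ , t) = Filled Lprev p′ q′ × intB p′ q′ a ≡ just t × p ≡ p′ + t × q ≡ q′ + t * a

secondStep-stores : ∀ α ord ordF n L y → Stores (SecondPartEntry (firstPart α ord (n ∸ 1)) (α n)) L →
                    Stores (SecondPartEntry (firstPart α ord (n ∸ 1)) (α n)) (secondStep α ord ordF n L y)
secondStep-stores α ord ordF n L (p′ , q′) stored p q t e
  with is-just (firstPart α ord (n ∸ 1) p′ q′) in filled | intB p′ q′ (α n) in root
... | true  | just x with insertIfEmpty-just {p′ + x} {q′ + x * α n} {p′ , q′ , x} {L} e
...   | inj₁ old                 = stored p q t old
...   | inj₂ (refl , refl , refl) = filled , root , refl , refl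
secondStep-stores α ord ordF n L (p′ , q′) stored p q t e | true  | nothing = stored p q t e
secondStep-stores α ord ordF n L (p′ , q′) stored p q t e | false | _       = stored p q t e

secondPart-sound : ∀ α ord ordF n → Stores (SecondPartEntry (firstPart α ord (n ∸ 1)) (α n)) (secondPart α ord ordF n)
secondPart-sound α ord ordF n = subst (Stores _) (sym (secondPart-unfold α ord ordF n))
  (foldl-preserves (Stores _) _ ordF (λ L y _ → secondStep-stores α ord ordF n L y) (λ _ _ _ ()))

secondStep-keeps : ∀ α ord ordF n L y {u v} → Filled L u v → Filled (secondStep α ord ordF n L y) u v
secondStep-keeps α ord ordF n L (p′ , q′) filled with is-just (firstPart α ord (n ∸ 1) p′ q′) | intB p′ q′ (α n)
... | true  | just x  = insertIfEmpty-keeps (p′ + x) (q′ + x * α n) (p′ , q′ , x) L filled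
... | true  | nothing = filled
... | false | _       = filled

secondPart-complete : ∀ α ord ordF n {p′ q′ t} → (p′ , q′) ∈ ordF → Filled (firstPart α ord (n ∸ 1)) p′ q′ →
                      intB p′ q′ (α n) ≡ just t → Filled (secondPart α ord ordF n) (p′ + t) (q′ + t * α n)
secondPart-complete α ord ordF n {p′} {q′} {t} p′q′∈ filled root =
  subst P (sym (secondPart-unfold α ord ordF n))
    (foldl-establishes P _ ordF p′q′∈ fill (λ L y → secondStep-keeps α ord ordF n L y))
  where
  P : Table → Set
  P L = Filled L (p′ + t) (q′ + t * α n)
  fill : ∀ L → P (secondStep α ord ordF n L (p′ , q′))
  fill L rewrite filled | root = insertIfEmpty-fills (p′ + t) (q′ + t * α n) (p′ , q′ , t) L

-- Correctness of the reconstruction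

expand-∷ʳ : ∀ {ℓ} α i (xs : Vec ℕ ℓ) x → expand α i (xs ∷ʳ x) ≡ expand α i xs ++ replicate x (α (i + ℓ))
expand-∷ʳ α i []       x = trans (List.++-identityʳ _) (cong (λ j → replicate x (α j)) (sym (+-identityʳ i)))
expand-∷ʳ {suc ℓ} α i (y ∷ xs) x = begin
  R ++ expand α (suc i) (xs ∷ʳ x)                     ≡⟨ cong (R ++_) (expand-∷ʳ α (suc i) xs x) ⟩
  R ++ (E ++ replicate x (α (suc i + ℓ)))             ≡⟨ List.++-assoc R E _ ⟨
  (R ++ E) ++ replicate x (α (suc i + ℓ))             ≡⟨ cong (λ j → (R ++ E) ++ replicate x (α j)) (sym (+-suc i ℓ)) ⟩
  (R ++ E) ++ replicate x (α (i + suc ℓ))             ∎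
  where
  open ≡-Reasoning
  R = replicate y (α i)
  E = expand α (suc i) xs

length-expand-∷ʳ : ∀ {ℓ} α (xs : Vec ℕ ℓ) x → length (expand α 1 (xs ∷ʳ x)) ≡ length (expand α 1 xs) + x
length-expand-∷ʳ {ℓ} α xs x = trans (cong length (expand-∷ʳ α 1 xs x)) (length-++-replicate (expand α 1 xs) x (α (suc ℓ)))

sum-expand-∷ʳ : ∀ {ℓ} α (xs : Vec ℕ ℓ) x → sum (expand α 1 (xs ∷ʳ x)) ≡ sum (expand α 1 xs) + x * α (suc ℓ)
sum-expand-∷ʳ {ℓ} α xs x = trans (cong sum (expand-∷ʳ α 1 xs x)) (sum-++-replicate (expand α 1 xs) x (α (suc ℓ)))

AllPos-∷ʳ : ∀ {ℓ} {xs : Vec ℕ ℓ} {x} → AllPos xs → 1 ≤ x → AllPos (xs ∷ʳ x)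
AllPos-∷ʳ []           1≤x = 1≤x ∷ []
AllPos-∷ʳ (1≤y ∷ pos) 1≤x = 1≤y ∷ AllPos-∷ʳ pos 1≤x

AllPos-∷ʳ⁻ : ∀ {ℓ} (xs : Vec ℕ ℓ) {x} → AllPos (xs ∷ʳ x) → AllPos xs × 1 ≤ x
AllPos-∷ʳ⁻ []       (1≤x ∷ []) = [] , 1≤x
AllPos-∷ʳ⁻ (y ∷ xs) (1≤y ∷ pos) = map₁ (1≤y ∷_) (AllPos-∷ʳ⁻ xs pos)

sum-expand≤ : ∀ α {ℓ} (zs : Vec ℕ ℓ) i c → (∀ j → j < ℓ → α (i + j) ≤ c) →
              sum (expand α i zs) ≤ length (expand α i zs) * c
sum-expand≤ α []       i c bounded = z≤n
sum-expand≤ α {suc ℓ} (z ∷ zs) i c bounded = begin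
  sum (replicate z (α i) ++ rest)                   ≡⟨ sum-++-replicate′ ⟩
  z * α i + sum rest                                ≤⟨ +-mono-≤ (*-monoʳ-≤ z first) (sum-expand≤ α zs (suc i) c later) ⟩
  z * c + length rest * c                           ≡⟨ *-distribʳ-+ c z (length rest) ⟨
  (z + length rest) * c                             ≡⟨ cong (_* c) length-++-replicate′ ⟨
  length (replicate z (α i) ++ rest) * c            ∎
  where
  open ≤-Reasoning
  rest = expand α (suc i) zs
  first : α i ≤ c
  first = subst (λ j → α j ≤ c) (+-identityʳ i) (bounded 0 (s≤s z≤n))
  later : ∀ j → j < ℓ → α (suc i + j) ≤ c
  later j j< = subst (λ j → α j ≤ c) (+-suc i j) (bounded (suc j) (s≤s j<))
  sum-++-replicate′ : sum (replicate z (α i) ++ rest) ≡ z * α i + sum rest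
  sum-++-replicate′ = trans (ListAction.sum-++ (replicate z (α i)) rest) (cong (_+ sum rest) (sum-replicate z (α i)))
  length-++-replicate′ : length (replicate z (α i) ++ rest) ≡ z + length rest
  length-++-replicate′ = trans (List.length-++ (replicate z (α i))) (cong (_+ length rest) (List.length-replicate z))

landau⇒InRange : ∀ P S c → C₂ P ≤ S → S ≤ P * c → InRange c P S
landau⇒InRange zero    S c _     S≤0     = z≤n , ≤-trans S≤0 z≤n
landau⇒InRange (suc P) S c C₂≤S S≤P*c = P≤2c+1 , ≤-trans S≤P*c (*-monoˡ-≤ c P≤2c+1)
  where
  regroup : ∀ P c → 2 * (P * c) + P ≡ P * (2 * c + 1)
  regroup = solve-∀
  P≤2c+1 : suc P ≤ 2 * c + 1
  P≤2c+1 = *-cancelˡ-≤ (suc P) (≤-trans (C₂≤⇒square≤ (suc P) S C₂≤S)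
             (≤-trans (+-monoˡ-≤ (suc P) (*-monoʳ-≤ 2 S≤P*c)) (≤-reflexive (regroup (suc P) c))))

∈-rangeList : ∀ a {p q} → InRange a p q → (p , q) ∈ rangeList a
∈-rangeList a {p} {q} (p≤ , q≤) =
  Membership.∈-concat⁺′ (Membership.∈-map⁺ (λ q → (p , q)) (Membership.∈-upTo⁺ (s≤s q≤)))
                        (Membership.∈-map⁺ row (Membership.∈-upTo⁺ (s≤s p≤)))
  where
  row : ℕ → List (ℕ × ℕ)
  row p = map (λ q → (p , q)) (upTo (suc ((2 * a + 1) * a)))

StrictlyIncreasing⇒monotone : ∀ {n α} → StrictlyIncreasing n α → ∀ {i j} → 1 ≤ i → i ≤ j → j ≤ n → α i ≤ α j
StrictlyIncreasing⇒monotone increasing {j = zero}  1≤i z≤n _ = contradiction 1≤i λ ()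
StrictlyIncreasing⇒monotone increasing {j = suc j} 1≤i i≤1+j 1+j≤n with m≤n⇒m<n∨m≡n i≤1+j
... | inj₂ refl  = ≤-refl
... | inj₁ i<1+j = ≤-trans (StrictlyIncreasing⇒monotone increasing 1≤i (≤-pred i<1+j) (≤-trans (n≤1+n j) 1+j≤n))
                           (<⇒≤ (increasing j (≤-trans 1≤i (≤-pred i<1+j)) 1+j≤n))

backtrack-∷ʳ : ∀ (L : ℕ → Table) ℓ {p q p′ q′ x xs} → L (suc ℓ) p q ≡ just (p′ , q′ , x) →
               backtrack L ℓ p′ q′ ≡ just xs → backtrack L (suc ℓ) p q ≡ just (xs ∷ʳ x)
backtrack-∷ʳ L ℓ stored rest rewrite stored | rest = refl

L₀-filled : ∀ {p q} → Filled L₀ p q → p ≡ 0 × q ≡ 0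
L₀-filled {p} {q} filled with p ≡ᵇ 0 in p≡0 | q ≡ᵇ 0 in q≡0
... | true  | true  = ≡ᵇ-true⇒≡ p≡0 , ≡ᵇ-true⇒≡ q≡0
... | true  | false = contradiction filled λ ()
... | false | _     = contradiction filled λ ()

-- what backtracking from cell (p, q) of L_ℓ reconstructs
record Prefix (α : ℕ → ℕ) (ℓ p q : ℕ) (xs : Vec ℕ ℓ) : Set where
  field
    positive : AllPos xs
    length≡  : length (expand α 1 xs) ≡ p
    sum≡     : sum (expand α 1 xs) ≡ q
    landau   : IsLandau (expand α 1 xs)
    sorted   : IsSorted (expand α 1 xs)
    bounded  : BoundedBy (A α ℓ) (expand α 1 xs)

Prefix-[] : ∀ {α} → Prefix α 0 0 0 []
Prefix-[] = record
  { positive = []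
  ; length≡  = refl
  ; sum≡     = refl
  ; landau   = λ { zero z≤n → z≤n }
  ; sorted   = λ _ ()
  ; bounded  = λ _ ()
  }

Prefix-∷ʳ : ∀ {α ℓ p q xs x} → Prefix α ℓ p q xs → 1 ≤ x → A α ℓ ≤ α (suc ℓ) →
            C₂ (p + x) ≤ q + x * α (suc ℓ) → Prefix α (suc ℓ) (p + x) (q + x * α (suc ℓ)) (xs ∷ʳ x)
Prefix-∷ʳ {α} {ℓ} {xs = xs} {x} prefix 1≤x Aℓ≤a bound = record
  { positive = AllPos-∷ʳ positive 1≤x
  ; length≡  = trans (length-expand-∷ʳ α xs x) (cong (_+ x) length≡)
  ; sum≡     = trans (sum-expand-∷ʳ α xs x) (cong (_+ x * a) sum≡)
  ; landau   = subst IsLandau (sym E′≡) (++-replicate-landau E x a landau bound′)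
  ; sorted   = subst IsSorted (sym E′≡) (++-replicate-sorted E (A α ℓ) x a sorted bounded Aℓ≤a)
  ; bounded  = subst (BoundedBy a) (sym E′≡) (++-replicate-bounded E (A α ℓ) x a bounded Aℓ≤a)
  }
  where
  open Prefix prefix
  a = α (suc ℓ)
  E = expand α 1 xs
  E′≡ : expand α 1 (xs ∷ʳ x) ≡ E ++ replicate x a
  E′≡ = expand-∷ʳ α 1 xs x
  bound′ : C₂ (length E + x) ≤ sum E + x * a
  bound′ = subst₂ (λ P Q → C₂ (P + x) ≤ Q + x * a) (sym length≡) (sym sum≡) bound

Prefix⇒C₂≤ : ∀ {α ℓ p q xs} → Prefix α ℓ p q xs → C₂ p ≤ q
Prefix⇒C₂≤ {α} {xs = xs} prefix =
  subst₂ (λ P Q → C₂ P ≤ Q) length≡ sum≡ (IsLandau⇒C₂≤sum (expand α 1 xs) landau)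
  where open Prefix prefix

module NetBuilding (k : ℕ) (α : ℕ → ℕ) (increasing : StrictlyIncreasing (suc (suc k)) α)
                   (ord : Order) (ordF : List (ℕ × ℕ)) where

  n : ℕ
  n = suc (suc k)

  L : ℕ → Table
  L = firstPart α ord

  net : ℕ → Table
  net = netTable α ord ordF n

  net-first : ∀ {ℓ} → ℓ < n → net ℓ ≡ L ℓ
  net-first ℓ<n rewrite ≢⇒≡ᵇ-false (<⇒≢ ℓ<n) = refl

  net-last : net n ≡ secondPart α ord ordF n
  net-last rewrite ≡ᵇ-refl n = refl

  A≤α-suc : ∀ ℓ → ℓ < n → A α ℓ ≤ α (suc ℓ)
  A≤α-suc zero    _     = z≤n
  A≤α-suc (suc ℓ) 1+ℓ<n = <⇒≤ (increasing (suc ℓ) (s≤s z≤n) 1+ℓ<n)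

  backtrack-first : ∀ ℓ → ℓ < n → ∀ {p q} → Filled (L ℓ) p q →
                    Σ (Vec ℕ ℓ) λ xs → backtrack net ℓ p q ≡ just xs × Prefix α ℓ p q xs
  backtrack-first zero _ {p} {q} filled with L₀-filled {p} {q} filled
  ... | refl , refl = [] , refl , Prefix-[]
  backtrack-first (suc ℓ) 1+ℓ<n {p} {q} filled with Filled⇒just {L (suc ℓ)} {p} {q} filled
  ... | (p′ , q′ , x) , stored with buildLevel-sound α ord (suc ℓ) (L ℓ) p q _ stored
  ...   | filled′ , passes , 1≤x , refl , refl with backtrack-first ℓ (<-trans (n<1+n ℓ) 1+ℓ<n) filled′
  ...     | xs , found , prefix =
    xs ∷ʳ x ,
    backtrack-∷ʳ net ℓ (trans (cong (λ T → T p q) (net-first 1+ℓ<n)) stored) found ,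
    Prefix-∷ʳ prefix 1≤x (A≤α-suc ℓ (<-trans (n<1+n ℓ) 1+ℓ<n)) (leB-sound p′ q′ (α (suc ℓ)) x (Prefix⇒C₂≤ prefix) passes)

  backtrack-last : ∀ {p q t} → net n p q ≡ just t →
                   Σ (Vec ℕ n) λ xs → backtrack net n p q ≡ just xs × CorrectScoreSeq α xs
  backtrack-last {p} {q} {p′ , q′ , x} stored
    with secondPart-sound α ord ordF n p q _ (trans (cong (λ T → T p q) (sym net-last)) stored)
  ... | filled′ , root , refl , refl with backtrack-first (suc k) ≤-refl filled′
  ...   | xs , found , prefix = xs ∷ʳ x , backtrack-∷ʳ net (suc k) stored found , positive ,
    landau⇒score-sequence (expand α 1 (xs ∷ʳ x)) sorted landau (trans sum≡ (trans (sym tight) (cong C₂ (sym length≡))))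
    where
    sound : 1 ≤ x × C₂ (p′ + x) ≡ q′ + x * α n
    sound = intB-sound p′ q′ (α n) x root
    tight = proj₂ sound
    open Prefix (Prefix-∷ʳ prefix (proj₁ sound) (A≤α-suc (suc k) ≤-refl) (≤-reflexive tight))

  sum-expand-bounded : ∀ ℓ → ℓ ≤ n → (ys : Vec ℕ ℓ) → sum (expand α 1 ys) ≤ length (expand α 1 ys) * A α ℓ
  sum-expand-bounded zero    _     []  = z≤n
  sum-expand-bounded (suc ℓ) 1+ℓ≤n ys = sum-expand≤ α ys 1 (α (suc ℓ))
    (λ j j<1+ℓ → StrictlyIncreasing⇒monotone increasing (s≤s z≤n) j<1+ℓ 1+ℓ≤n)

  module _ (ord-perm : ∀ ℓ x → 1 ≤ ℓ → ℓ < n → 1 ≤ x → x ≤ 2 * A α ℓ + 1 → ord ℓ x ↭ rangeList (A α (ℓ ∸ 1)))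
           where

    prefix-filled : ∀ {E₀} → IsLandau E₀ → ∀ ℓ → ℓ < n → (ys : Vec ℕ ℓ) (rest : List ℕ) → AllPos ys →
                    expand α 1 ys ++ rest ≡ E₀ → Filled (L ℓ) (length (expand α 1 ys)) (sum (expand α 1 ys))
    prefix-filled landau₀ zero    _     []  rest _        _         = refl
    prefix-filled landau₀ (suc ℓ) 1+ℓ<n ys rest positive ys++rest with initLast ys
    ... | zs , x , refl = subst₂ (Filled (L (suc ℓ))) (sym length≡) (sym sum≡) filled
      where
      a = α (suc ℓ)
      Ez = expand α 1 zs
      E≡ : expand α 1 (zs ∷ʳ x) ≡ Ez ++ replicate x a
      E≡ = expand-∷ʳ α 1 zs x
      length≡ = length-expand-∷ʳ α zs x
      sum≡ = sum-expand-∷ʳ α zs x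
      positive′ : AllPos zs × 1 ≤ x
      positive′ = AllPos-∷ʳ⁻ zs positive
      zs++rest : Ez ++ (replicate x a ++ rest) ≡ _
      zs++rest = trans (sym (List.++-assoc Ez (replicate x a) rest)) (trans (cong (_++ rest) (sym E≡)) ys++rest)
      landau-zs : C₂ (length Ez) ≤ sum Ez
      landau-zs = IsLandau-prefix Ez (replicate x a ++ rest) (subst IsLandau (sym zs++rest) landau₀)
      landau-ys : C₂ (length Ez + x) ≤ sum Ez + x * a
      landau-ys = subst₂ (λ P Q → C₂ P ≤ Q) length≡ sum≡
        (IsLandau-prefix (expand α 1 (zs ∷ʳ x)) rest (subst IsLandau (sym ys++rest) landau₀))
      x≤ : x ≤ 2 * a + 1
      x≤ = ≤-trans (m≤n+m x (length Ez)) (proj₁ (landau⇒InRange (length Ez + x) (sum Ez + x * a) a landau-ys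
             (subst₂ (λ P Q → Q ≤ P * a) length≡ sum≡ (sum-expand-bounded (suc ℓ) (<⇒≤ 1+ℓ<n) (zs ∷ʳ x)))))
      range-zs : InRange (A α ℓ) (length Ez) (sum Ez)
      range-zs = landau⇒InRange (length Ez) (sum Ez) (A α ℓ) landau-zs
        (sum-expand-bounded ℓ (<⇒≤ (<-trans (n<1+n ℓ) 1+ℓ<n)) zs)
      listed : (length Ez , sum Ez) ∈ ord (suc ℓ) x
      listed = Permutation.∈-resp-↭ (↭-sym (ord-perm (suc ℓ) x (s≤s z≤n) 1+ℓ<n (proj₂ positive′) x≤))
        (∈-rangeList (A α ℓ) range-zs)
      filled : Filled (L (suc ℓ)) (length Ez + x) (sum Ez + x * a)
      filled = buildLevel-complete α ord (suc ℓ) (L ℓ) (proj₂ positive′) x≤ listed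
        (prefix-filled landau₀ ℓ (<-trans (n<1+n ℓ) 1+ℓ<n) zs (replicate x a ++ rest) (proj₁ positive′) zs++rest)
        (leB-complete (length Ez) (sum Ez) a x landau-ys)

    last-filled : ordF ↭ rangeList (α (n ∸ 1)) → ∀ xs₀ → CorrectScoreSeq α xs₀ →
                  Σ ℕ λ p → Σ ℕ λ q → InRange (α n) p q × Σ Triple λ t → net n p q ≡ just t
    last-filled ordF-perm xs₀ (positive , score-sequence) with initLast xs₀
    ... | zs , x , refl = P , Q , range , Filled⇒just {net n} (subst (λ T → Filled T P Q) (sym net-last) filled)
      where
      a = α n
      Ez = expand α 1 zs
      P = length Ez + x
      Q = sum Ez + x * a
      E≡ : expand α 1 (zs ∷ʳ x) ≡ Ez ++ replicate x a
      E≡ = expand-∷ʳ α 1 zs x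
      length≡ = length-expand-∷ʳ α zs x
      sum≡ = sum-expand-∷ʳ α zs x
      positive′ : AllPos zs × 1 ≤ x
      positive′ = AllPos-∷ʳ⁻ zs positive
      landau₀ : IsLandau (expand α 1 (zs ∷ʳ x)) × sum (expand α 1 (zs ∷ʳ x)) ≡ C₂ (length (expand α 1 (zs ∷ʳ x)))
      landau₀ = score-sequence⇒landau (expand α 1 (zs ∷ʳ x)) score-sequence
      landau-zs : C₂ (length Ez) ≤ sum Ez
      landau-zs = IsLandau-prefix Ez (replicate x a) (subst IsLandau E≡ (proj₁ landau₀))
      tight : C₂ P ≡ Q
      tight = trans (cong C₂ (sym length≡)) (trans (sym (proj₂ landau₀)) sum≡)
      range : InRange a P Q
      range = landau⇒InRange P Q a (≤-reflexive tight)
        (subst₂ (λ P Q → Q ≤ P * a) length≡ sum≡ (sum-expand-bounded n ≤-refl (zs ∷ʳ x)))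
      range-zs : InRange (α (suc k)) (length Ez) (sum Ez)
      range-zs = landau⇒InRange (length Ez) (sum Ez) (α (suc k)) landau-zs (sum-expand-bounded (suc k) (n≤1+n _) zs)
      listed : (length Ez , sum Ez) ∈ ordF
      listed = Permutation.∈-resp-↭ (↭-sym ordF-perm) (∈-rangeList (α (suc k)) range-zs)
      filled : Filled (secondPart α ord ordF n) P Q
      filled = secondPart-complete α ord ordF n listed
        (prefix-filled (proj₁ landau₀) (suc k) ≤-refl zs (replicate x a) (proj₁ positive′) (sym E≡))
        (intB-complete (length Ez) (sum Ez) a x (proj₂ positive′) landau-zs tight)

theorem3p6 : (n : ℕ) → 2 ≤ n → (α : ℕ → ℕ) → StrictlyIncreasing n α
    → Σ (Vec ℕ n) (λ xs → CorrectScoreSeq α xs)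
    → (ord : Order) (ordF : List (ℕ × ℕ))
    → (∀ ℓ x → 1 ≤ ℓ → ℓ < n → 1 ≤ x → x ≤ 2 Data.Nat.* A α ℓ Data.Nat.+ 1
         → ord ℓ x ↭ rangeList (A α (ℓ ∸ 1)))
    → ordF ↭ rangeList (α (n ∸ 1))
    → (Σ ℕ λ p → Σ ℕ λ q → InRange (α n) p q
         × Σ Triple λ t → netTable α ord ordF n n p q ≡ just t)
      × (∀ p q → InRange (α n) p q → (t : Triple)
         → netTable α ord ordF n n p q ≡ just t
         → Σ (Vec ℕ n) λ xs → backtrack (netTable α ord ordF n) n p q ≡ just xs
              × CorrectScoreSeq α xs)
theorem3p6 (suc (suc k)) (s≤s (s≤s z≤n)) α increasing (xs₀ , correct) ord ordF ord-perm ordF-perm =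
  last-filled ord-perm ordF-perm xs₀ correct , λ p q _ t stored → backtrack-last stored
  where open NetBuilding k α increasing ord ordF
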